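{- The distance cube polynomials of the Lucas-run graphs satisfy, as an identity of formal power series in $t$, $$\sum_{n\geq 0} D_{\mathcal{R}_n^l}(x,q)\, t^n=\frac{1+(q+2x)t^2+2x(q+x)t^4}{1-t-qt^2-xt^3-x(q+x)t^5}.$$
   Context: Binary strings and hypercube. For $n\ge 0$ let $\mathcal{B}_n$ be the set of binary strings of length $n$ (the only string of length $0$ is the empty string). The weight $w(u)$ of a binary string $u$ is its number of 1s, and $0^n$ is the all-zero string of length $n$. The hypercube $Q_n$ has vertex set $\mathcal{B}_n$, and two strings are adjacent iff they differ in exactly one position. Run-constrained strings. A run in a binary string is a maximal substring of equal bits. A binary string is run-constrained if every run of 1s is immediately followed by a strictly longer run of 0s. It is circular-run-constrained if every run of 1s is immediately followed, reading the string circularly, by a strictly longer run of 0s. Lucas-run graph. $\mathcal{R}_n^l$ is the subgraph of $Q_n$ induced by $\{s\in\mathcal{B}_n : s0 \text{ is circular-run-constrained and } s00 \text{ is run-constrained}\}$. Distance cube polynomial. Let $G$ be an induced subgraph of $Q_n$ containing $0^n$. Every induced subgraph $H$ of $G$ isomorphic to some $Q_k$ has a unique vertex of minimum weight, its bottom vertex. Define $D_G(x,q)=\sum_{k,d\ge0}c_{k,d}x^kq^d$, where $c_{k,d}$ is the number of induced subgraphs of $G$ that are isomorphic to $Q_k$ and whose bottom vertex has weight $d$. -}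

module Defs where

open import Data.Bool using (Bool; true; false; if_then_else_; _∧_)
open import Data.Nat using (ℕ; zero; suc; _+_; _∸_; _^_; _≤_; _<_; _≤ᵇ_; _≡ᵇ_)
open import Data.List using (List; []; _∷_; _++_; map; length)
open import Data.Vec using (Vec; []; _∷_; toList)
open import Data.Product using (Σ; _×_; _,_; ∃)
open import Data.Unit using (⊤)
open import Data.Empty using (⊥)
open import Data.List.Membership.Propositional using (_∈_)
open import Data.List.Relation.Unary.All using (All)
open import Data.List.Relation.Unary.Unique.Propositional using (Unique)
open import Function.Bundles using (_⇔_)
open import Relation.Binary.PropositionalEquality using (_≡_)

-- Binary strings: true = 1, false = 0.

weight : {n : ℕ} → Vec Bool n → ℕ
weight [] = 0
weight (true ∷ u) = suc (weight u)
weight (false ∷ u) = weight u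

hamming : {n : ℕ} → Vec Bool n → Vec Bool n → ℕ
hamming [] [] = 0
hamming (true ∷ u) (true ∷ v) = hamming u v
hamming (false ∷ u) (false ∷ v) = hamming u v
hamming (true ∷ u) (false ∷ v) = suc (hamming u v)
hamming (false ∷ u) (true ∷ v) = suc (hamming u v)

Adj : {n : ℕ} → Vec Bool n → Vec Bool n → Set
Adj u v = hamming u v ≡ 1

allV : (n : ℕ) → List (Vec Bool n)
allV zero = [] ∷ []
allV (suc n) = map (false ∷_) (allV n) ++ map (true ∷_) (allV n)

_==_ : Bool → Bool → Bool
true == true = true
false == false = true
_ == _ = false

push : Bool → List (Bool × ℕ) → List (Bool × ℕ)
push b [] = (b , 1) ∷ []
push b ((c , k) ∷ rs) = if b == c then (c , suc k) ∷ rs else (b , 1) ∷ (c , k) ∷ rs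

runs : List Bool → List (Bool × ℕ)
runs [] = []
runs (b ∷ xs) = push b (runs xs)

RCruns : List (Bool × ℕ) → Set
RCruns [] = ⊤
RCruns ((false , _) ∷ rs) = RCruns rs
RCruns ((true , a) ∷ []) = ⊥
RCruns ((true , a) ∷ (false , b) ∷ rs) = (a < b) × RCruns ((false , b) ∷ rs)
RCruns ((true , a) ∷ (true , b) ∷ rs) = ⊥

RunConstrained : List Bool → Set
RunConstrained s = RCruns (runs s)

-- circular runs: if there are at least two runs and the first and last
-- have the same bit, they merge into one circular run
mergeLast : Bool × ℕ → List (Bool × ℕ) → List (Bool × ℕ)
mergeLast (b , a) [] = (b , a) ∷ []
mergeLast (b , a) ((c , k) ∷ []) = if b == c then (b , a + k) ∷ [] else (b , a) ∷ (c , k) ∷ []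
mergeLast (b , a) (r ∷ r' ∷ rs) with mergeLast (b , a) (r' ∷ rs)
... | [] = []
... | h ∷ t = h ∷ r ∷ t

circRuns : List Bool → List (Bool × ℕ)
circRuns s with runs s
... | [] = []
... | r ∷ rs = mergeLast r rs

-- cyclic check: `first` is the run that follows the last run cyclically
RCcyc : Bool × ℕ → List (Bool × ℕ) → Set
RCcyc first [] = ⊤
RCcyc first ((false , _) ∷ rs) = RCcyc first rs
RCcyc (false , b) ((true , a) ∷ []) = a < b
RCcyc (true , b) ((true , a) ∷ []) = ⊥
RCcyc first ((true , a) ∷ (false , b) ∷ rs) = (a < b) × RCcyc first ((false , b) ∷ rs)
RCcyc first ((true , a) ∷ (true , b) ∷ rs) = ⊥

CircRunConstrained : List Bool → Set
CircRunConstrained s with circRuns s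
... | [] = ⊤
... | r ∷ rs = RCcyc r (r ∷ rs)

InLucasRun : {n : ℕ} → Vec Bool n → Set
InLucasRun s = CircRunConstrained (toList s ++ false ∷ [])
             × RunConstrained (toList s ++ false ∷ false ∷ [])

-- Induced subgraphs isomorphic to Q_k, with bottom weight d.
-- A vertex subset of B_n is given by a mask over the enumeration allV n.

select : {A : Set} → List Bool → List A → List A
select [] _ = []
select (_ ∷ _) [] = []
select (true ∷ m) (x ∷ xs) = x ∷ select m xs
select (false ∷ m) (x ∷ xs) = select m xs

InducedIsoCube : (n k : ℕ) → List (Vec Bool n) → Set
InducedIsoCube n k S =
  Σ (Vec Bool k → Vec Bool n) λ f →
      (∀ u → f u ∈ S)
    × (∀ v → v ∈ S → ∃ λ u → f u ≡ v)
    × (∀ u w → f u ≡ f w → u ≡ w)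
    × (∀ u w → (Adj u w ⇔ Adj (f u) (f w)))

BottomWeight : {n : ℕ} → ℕ → List (Vec Bool n) → Set
BottomWeight d S = (∃ λ v → v ∈ S × weight v ≡ d) × (∀ v → v ∈ S → d ≤ weight v)

LRCube : (n k d : ℕ) → List Bool → Set
LRCube n k d m =
    length m ≡ length (allV n)
  × All InLucasRun (select m (allV n))
  × InducedIsoCube n k (select m (allV n))
  × BottomWeight d (select m (allV n))

HasCount : (List Bool → Set) → ℕ → Set
HasCount P c = Σ (List (List Bool)) λ L →
  Unique L × (∀ m → (m ∈ L ⇔ P m)) × length L ≡ c

-- Formal power series in t with coefficients in ℕ[x,q]:
-- a function F n k d = coefficient of t^n x^k q^d.

-- coefficient of t^n x^k q^d in t^a x^b q^e · F
shift : (ℕ → ℕ → ℕ → ℕ) → ℕ → ℕ → ℕ → ℕ → ℕ → ℕ → ℕ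
shift F a b e n k d =
  if (a ≤ᵇ n) ∧ ((b ≤ᵇ k) ∧ (e ≤ᵇ d)) then F (n ∸ a) (k ∸ b) (d ∸ e) else 0

-- numerator 1 + (q+2x) t^2 + 2x(q+x) t^4
numer : ℕ → ℕ → ℕ → ℕ
numer 0 0 0 = 1
numer 2 0 1 = 1
numer 2 1 0 = 2
numer 4 1 1 = 2
numer 4 2 0 = 2
numer _ _ _ = 0

-- F · (1 - t - q t^2 - x t^3 - x(q+x) t^5) = numerator, written over ℕ as
-- F = numerator + (t + q t^2 + x t^3 + xq t^5 + x^2 t^5) F
SatisfiesGF : (ℕ → ℕ → ℕ → ℕ) → Set
SatisfiesGF F = ∀ n k d →
  F n k d ≡ numer n k d
          + shift F 1 0 0 n k d
          + shift F 2 0 1 n k d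
          + shift F 3 1 0 n k d
          + shift F 5 1 1 n k d
          + shift F 5 2 0 n k d

-- A vertex set spans an induced Q_k in Q_n exactly when it is the set of matches of a
-- pattern over {0, 1, X} with k letters X, and its bottom vertex then has as many 1s as
-- the pattern.  So D counts patterns all of whose matches are Lucas-run vertices.
-- Run-constrained strings form a regular language, and "every match is accepted" is again
-- a regular property of patterns, decided by a small pattern automaton.  The accepted
-- patterns ending in a settled state, or one 0 short of it, are generated freely from the
-- patterns ε, 10, X0, X100, XX00 by prefixing 0, widening the first run of ones, and
-- prefixing X00, X1000, XX000: these steps contribute t, qt², xt³, xqt⁵, x²t⁵, the
-- denominator.  The remaining valid patterns are the rotations of the one-short ones, so
-- the base patterns give the numerator, less qt² since the empty pattern is not widened.

module Submission where

open import Defs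

open import Data.Bool using (Bool; true; false; not; _∧_; if_then_else_)
open import Data.Bool.Properties using (∧-zeroʳ; not-involutive; not-¬)
open import Data.Empty using (⊥; ⊥-elim)
open import Data.Fin using (Fin; zero; suc) renaming (_≟_ to _≟ᶠ_)
open import Data.List
  using (List; []; _∷_; _++_; [_]; _∷ʳ_; concat; concatMap; filter; foldl; initLast; _∷ʳ′_; length; map; replicate)
open import Data.List.Properties
  using (++-assoc; ++-identityʳ; ∷-injectiveʳ; foldl-++; foldl-∷ʳ; length-map; map-cong-local; map-id)
open import Data.List.Membership.Propositional using (_∈_; find)
open import Data.List.Membership.Propositional.Properties
  using (∈-++⁺ˡ; ∈-++⁺ʳ; ∈-++⁻; ∈-concat⁺′; ∈-concatMap⁻; ∈-filter⁺; ∈-filter⁻; ∈-map⁺; ∈-map⁻)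
open import Data.List.Relation.Binary.Pointwise using (Pointwise; []; _∷_; Pointwise-length)
import Data.List.Relation.Binary.Pointwise as Pointwise
open import Data.List.Relation.Unary.All as All using (All; []; _∷_)
open import Data.List.Relation.Unary.AllPairs using ([]; _∷_)
open import Data.List.Relation.Unary.Any using (here; there)
open import Data.List.Relation.Unary.Unique.Propositional using (Unique)
import Data.List.Relation.Unary.Unique.Propositional.Properties as Unique
open import Data.Nat using (ℕ; zero; suc; _+_; _∸_; _≤_; _<_; z≤n; s≤s; _≤ᵇ_; _≡ᵇ_; _≟_; _≤?_)
open import Data.Nat.Induction using (<-wellFounded)
open import Data.Nat.ListAction using (sum)
open import Data.Nat.Properties
  using (0∸n≡0; m≤n⇒m∸n≡0; m∸n≡0⇒m≤n; ≤-pred; ≰⇒>; suc-injective; +-∸-assoc; +-comm; +-assoc; +-suc;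
         +-identityʳ; n<1+n; m<n+m; m≤m+n; ≤-antisym)
open import Data.Nat.Solver using (module +-*-Solver)
open import Data.Product using (Σ; ∃; ∃₂; _×_; _,_; proj₁; proj₂)
open import Data.Sum using (_⊎_; inj₁; inj₂)
open import Data.Unit using (tt)
open import Data.Vec using (Vec; []; _∷_; toList; lookup; updateAt; _[_]≔_)
import Data.Vec as Vec
open import Data.Vec.Properties using (length-toList; lookup∘updateAt; lookup∘updateAt′; toList∘fromList)
open import Function using (_∘_)
open import Function.Bundles using (_⇔_; mk⇔; Equivalence)
open import Function.Properties.Equivalence using () renaming (refl to ⇔-refl; sym to ⇔-sym; trans to ⇔-trans)
open import Induction.WellFounded using (Acc; acc)
open import Relation.Binary.PropositionalEquality using (_≡_; _≢_; refl; sym; trans; cong; cong₂; subst; subst₂)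
open import Relation.Nullary using (¬_; Dec; yes; no; does)
open import Relation.Nullary.Decidable using (_×-dec_)
open import Relation.Unary using (Decidable)

≡⇒⇔ : ∀ {A B : Set} → A ≡ B → A ⇔ B
≡⇒⇔ refl = ⇔-refl

replicate-++-∷ : ∀ {A : Set} n (x : A) s → replicate n x ++ x ∷ s ≡ x ∷ replicate n x ++ s
replicate-++-∷ zero    x s = refl
replicate-++-∷ (suc n) x s = cong (x ∷_) (replicate-++-∷ n x s)

Unique-map⁺-local : ∀ {A B : Set} (f : A → B) {xs} → Unique xs →
  (∀ {x y} → x ∈ xs → y ∈ xs → f x ≡ f y → x ≡ y) → Unique (map f xs)
Unique-map⁺-local f {[]}     []           _   = []
Unique-map⁺-local f {x ∷ xs} (x∉xs ∷ uxs) inj =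
  All.tabulate fresh ∷ Unique-map⁺-local f uxs (λ mx my → inj (there mx) (there my))
  where
  fresh : ∀ {y} → y ∈ map f xs → f x ≢ y
  fresh m eq with z , z∈xs , refl ← ∈-map⁻ f m = All.lookup x∉xs z∈xs (inj (here refl) (there z∈xs) eq)

Unique-concatMap-images : ∀ {I A : Set} (f : I → A → A) (decode : A → I × A) (G : I → List A) {is} →
  Unique is → (∀ i → Unique (G i)) → (∀ i {x} → x ∈ G i → decode (f i x) ≡ (i , x)) →
  Unique (concatMap (λ i → map (f i) (G i)) is)
Unique-concatMap-images f decode G {[]}     []          _  _      = []
Unique-concatMap-images f decode G {i ∷ is} (i∉is ∷ ui) uG decodes =
  Unique.++⁺ (Unique-map⁺-local (f i) (uG i) injective)
             (Unique-concatMap-images f decode G ui uG decodes) disjoint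
  where
  injective : ∀ {x y} → x ∈ G i → y ∈ G i → f i x ≡ f i y → x ≡ y
  injective mx my eq = cong proj₂ (trans (sym (decodes i mx)) (trans (cong decode eq) (decodes i my)))
  index : ∀ {j x} → x ∈ map (f j) (G j) → proj₁ (decode x) ≡ j
  index {j} m with _ , my , refl ← ∈-map⁻ (f j) m = cong proj₁ (decodes j my)
  disjoint : ∀ {x} → x ∈ map (f i) (G i) × x ∈ concatMap (λ j → map (f j) (G j)) is → ⊥
  disjoint (m₁ , m₂) with j , j∈is , m ← find (∈-concatMap⁻ (λ j → map (f j) (G j)) {xs = is} m₂) =
    All.lookup i∉is j∈is (trans (sym (index m₁)) (index m))

length-filter-++ : ∀ {A : Set} {P : A → Set} (P? : Decidable P) xs ys →
  length (filter P? (xs ++ ys)) ≡ length (filter P? xs) + length (filter P? ys)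
length-filter-++ P? []       ys = refl
length-filter-++ P? (x ∷ xs) ys with does (P? x)
... | true  = cong suc (length-filter-++ P? xs ys)
... | false = length-filter-++ P? xs ys

length-filter-map : ∀ {A B : Set} {P : B → Set} {Q : A → Set} (P? : Decidable P) (Q? : Decidable Q)
  (f : A → B) b xs → (∀ {x} → x ∈ xs → does (P? (f x)) ≡ b ∧ does (Q? x)) →
  length (filter P? (map f xs)) ≡ (if b then length (filter Q? xs) else 0)
length-filter-map P? Q? f true  []       h = refl
length-filter-map P? Q? f false []       h = refl
length-filter-map P? Q? f true  (x ∷ xs) h
  with does (P? (f x)) | does (Q? x) | h (here refl) | length-filter-map P? Q? f true xs (h ∘ there)
... | true  | true  | refl | ih = cong suc ih
... | false | false | refl | ih = ih
length-filter-map P? Q? f false (x ∷ xs) h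
  with does (P? (f x)) | h (here refl) | length-filter-map P? Q? f false xs (h ∘ there)
... | false | refl | ih = ih

length-filter-concat : ∀ {A : Set} {P : A → Set} (P? : Decidable P) xss →
  length (filter P? (concat xss)) ≡ sum (map (length ∘ filter P?) xss)
length-filter-concat P? []         = refl
length-filter-concat P? (xs ∷ xss) =
  trans (length-filter-++ P? xs (concat xss)) (cong (length (filter P? xs) +_) (length-filter-concat P? xss))

≤ᵇ-suc : ∀ a k → (suc a ≤ᵇ suc k) ≡ (a ≤ᵇ k)
≤ᵇ-suc zero    k = refl
≤ᵇ-suc (suc a) k = refl

+-≡ᵇ : ∀ a m k → (a + m ≡ᵇ k) ≡ (a ≤ᵇ k) ∧ (m ≡ᵇ k ∸ a)
+-≡ᵇ zero    m k       = refl
+-≡ᵇ (suc a) m zero    = refl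
+-≡ᵇ (suc a) m (suc k) = trans (+-≡ᵇ a m k) (cong (_∧ (m ≡ᵇ k ∸ a)) (sym (≤ᵇ-suc a k)))

∧-interchange : ∀ a b c d → (a ∧ b) ∧ (c ∧ d) ≡ (a ∧ c) ∧ (b ∧ d)
∧-interchange true  true  c d = refl
∧-interchange true  false c d = sym (∧-zeroʳ c)
∧-interchange false b     c d = refl

dropLast : ∀ {A : Set} → List A → List A
dropLast []           = []
dropLast (x ∷ [])     = []
dropLast (x ∷ y ∷ xs) = x ∷ dropLast (y ∷ xs)

dropLast-∷ʳ : ∀ {A : Set} (xs : List A) x → dropLast (xs ∷ʳ x) ≡ xs
dropLast-∷ʳ []           x = refl
dropLast-∷ʳ (y ∷ [])     x = refl
dropLast-∷ʳ (y ∷ z ∷ xs) x = cong (y ∷_) (dropLast-∷ʳ (z ∷ xs) x)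

select-⊆ : ∀ {A : Set} m (L : List A) {x} → x ∈ select m L → x ∈ L
select-⊆ (true ∷ m)  (y ∷ L) (here refl) = here refl
select-⊆ (true ∷ m)  (y ∷ L) (there s)   = there (select-⊆ m L s)
select-⊆ (false ∷ m) (y ∷ L) s           = there (select-⊆ m L s)

∈-select-map⁻ : ∀ {A : Set} (g : A → Bool) L {x} → x ∈ select (map g L) L → g x ≡ true
∈-select-map⁻ g (y ∷ L) s with g y in gy
∈-select-map⁻ g (y ∷ L) (here refl) | true  = gy
∈-select-map⁻ g (y ∷ L) (there s)   | true  = ∈-select-map⁻ g L s
∈-select-map⁻ g (y ∷ L) s           | false = ∈-select-map⁻ g L s

∈-select-map⁺ : ∀ {A : Set} (g : A → Bool) L {x} → x ∈ L → g x ≡ true → x ∈ select (map g L) L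
∈-select-map⁺ g (y ∷ L) (here refl) gx with g y
... | true = here refl
∈-select-map⁺ g (y ∷ L) (there x∈) gx with g y
... | true  = there (∈-select-map⁺ g L x∈ gx)
... | false = ∈-select-map⁺ g L x∈ gx

select-determines-mask : ∀ {A : Set} (g : A → Bool) L m → Unique L → length m ≡ length L →
  (∀ {x} → x ∈ L → x ∈ select m L ⇔ g x ≡ true) → m ≡ map g L
select-determines-mask g []      []      _            _   _       = refl
select-determines-mask g (y ∷ L) (b ∷ m) (y∉L ∷ uL) len selects =
  cong₂ _∷_ (head b selects) (select-determines-mask g L m uL (suc-injective len) (tail b selects))
  where
  y∉select : ∀ m′ → y ∈ select m′ L → ⊥
  y∉select m′ s = All.lookup y∉L (select-⊆ m′ L s) refl
  Selects : Bool → Set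
  Selects b = ∀ {x} → x ∈ y ∷ L → x ∈ select (b ∷ m) (y ∷ L) ⇔ g x ≡ true
  head : ∀ b → Selects b → b ≡ g y
  head true  selects = sym (Equivalence.to (selects (here refl)) (here refl))
  head false selects with g y in gy
  ... | true  = ⊥-elim (y∉select m (Equivalence.from (selects (here refl)) gy))
  ... | false = refl
  tail : ∀ b → Selects b → ∀ {x} → x ∈ L → x ∈ select m L ⇔ g x ≡ true
  tail false selects x∈ = selects (there x∈)
  tail true  selects {x} x∈ =
    mk⇔ (Equivalence.to (selects (there x∈)) ∘ there) (drop ∘ Equivalence.from (selects (there x∈)))
    where
    drop : x ∈ y ∷ select m L → x ∈ select m L
    drop (here refl) = ⊥-elim (All.lookup y∉L x∈ refl)
    drop (there s)   = s

toList-onto : ∀ {A : Set} {n} (s : List A) → length s ≡ n → ∃ λ (v : Vec A n) → toList v ≡ s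
toList-onto s refl = Vec.fromList s , toList∘fromList s

does≡true⇔ : ∀ {A : Set} (a? : Dec A) → does a? ≡ true ⇔ A
does≡true⇔ (yes a) = mk⇔ (λ _ → a) (λ _ → refl)
does≡true⇔ (no ¬a) = mk⇔ (λ ()) (λ a → ⊥-elim (¬a a))

-- Run-constrained strings as a regular language

-- need m: inside a run of 0s that must grow by m more 0s before a 1 may follow;
-- ones n: inside a run of n + 1 ones.
data RunState : Set where
  need : ℕ → RunState
  ones : ℕ → RunState
  dead : RunState

step : RunState → Bool → RunState
step (need zero)    false = need zero
step (need (suc m)) false = need m
step (need zero)    true  = ones zero
step (need (suc m)) true  = dead
step (ones n)       true  = ones (suc n)
step (ones n)       false = need (suc n)
step dead           _     = dead

run : RunState → List Bool → RunState
run = foldl step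

Accepts : RunState → List Bool → Set
Accepts σ s = run σ s ≡ need 0

run-dead : ∀ s → run dead s ≡ dead
run-dead []      = refl
run-dead (_ ∷ s) = run-dead s

dead-rejects : ∀ s → ¬ Accepts dead s
dead-rejects s ok with () ← trans (sym (run-dead s)) ok

accepts-need-suc : ∀ m s → Accepts (need (suc m)) s → Accepts (need m) s
accepts-need-suc m       []          ()
accepts-need-suc zero    (false ∷ s) ok = ok
accepts-need-suc (suc m) (false ∷ s) ok = accepts-need-suc m s ok
accepts-need-suc m       (true ∷ s)  ok = ⊥-elim (dead-rejects s ok)

accepts-ones-suc : ∀ n s → Accepts (ones (suc n)) s → Accepts (ones n) s
accepts-ones-suc n []          ()
accepts-ones-suc n (true ∷ s)  ok = accepts-ones-suc (suc n) s ok
accepts-ones-suc n (false ∷ s) ok = accepts-need-suc (suc n) s ok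

accepts-ones-zero : ∀ s → Accepts (ones 0) s → Accepts (need 0) s
accepts-ones-zero []          ()
accepts-ones-zero (true ∷ s)  ok = accepts-ones-suc 0 s ok
accepts-ones-zero (false ∷ s) ok = accepts-need-suc 0 s ok

run-zeros : ∀ n → run (need 0) (replicate n false) ≡ need 0
run-zeros zero    = refl
run-zeros (suc n) = run-zeros n

accepts-zeros-++ : ∀ n s → Accepts (need 0) (replicate n false ++ s) ⇔ Accepts (need 0) s
accepts-zeros-++ n s rewrite foldl-++ step (need 0) (replicate n false) s | run-zeros n = ⇔-refl

accepts-++-zeros : ∀ s n → Accepts (need 0) s → Accepts (need 0) (s ++ replicate n false)
accepts-++-zeros s n ok rewrite foldl-++ step (need 0) s (replicate n false) | ok = run-zeros n

accepts-++-0⇒00 : ∀ s → Accepts (need 0) (s ++ [ false ]) → Accepts (need 0) (s ++ false ∷ false ∷ [])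
accepts-++-0⇒00 s ok =
  subst (Accepts (need 0)) (++-assoc s [ false ] [ false ]) (accepts-++-zeros (s ++ [ false ]) 1 ok)

push-same : ∀ b k rs → push b ((b , k) ∷ rs) ≡ (b , suc k) ∷ rs
push-same true  k rs = refl
push-same false k rs = refl

push-other : ∀ b k rs → push b ((not b , k) ∷ rs) ≡ (b , 1) ∷ (not b , k) ∷ rs
push-other true  k rs = refl
push-other false k rs = refl

runs-∷ : ∀ b s → ∃₂ λ k rs → runs (b ∷ s) ≡ (b , k) ∷ rs
runs-∷ b [] = 1 , [] , refl
runs-∷ b (c ∷ s) with runs-∷ c s
runs-∷ true  (true  ∷ s) | k , rs , eq rewrite eq = suc k , rs , refl
runs-∷ true  (false ∷ s) | k , rs , eq rewrite eq = 1 , (false , k) ∷ rs , refl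
runs-∷ false (true  ∷ s) | k , rs , eq rewrite eq = 1 , (true , k) ∷ rs , refl
runs-∷ false (false ∷ s) | k , rs , eq rewrite eq = suc k , rs , refl

runs-replicate : ∀ b j s → runs (replicate (suc j) b ++ not b ∷ s) ≡ (b , suc j) ∷ runs (not b ∷ s)
runs-replicate b zero s with runs-∷ (not b) s
... | k , rs , eq rewrite eq = push-other b k rs
runs-replicate b (suc j) s rewrite runs-replicate b j s = push-same b (suc j) _

runs-replicate-[] : ∀ b j → runs (replicate (suc j) b) ≡ (b , suc j) ∷ []
runs-replicate-[] b zero    = refl
runs-replicate-[] b (suc j) rewrite runs-replicate-[] b j = push-same b (suc j) []

step-need-false : ∀ a j → step (need (a ∸ j)) false ≡ need (a ∸ suc j)
step-need-false zero          zero    = refl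
step-need-false zero          (suc j) = refl
step-need-false (suc zero)    zero    = refl
step-need-false (suc (suc a)) zero    = refl
step-need-false (suc a)       (suc j) = step-need-false a j

runConstrained-runs : ∀ s {rs} → runs s ≡ rs → RunConstrained s ⇔ RCruns rs
runConstrained-runs s eq = ≡⇒⇔ (cong RCruns eq)

accepts-≡ : ∀ {σ τ} s → σ ≡ τ → Accepts σ s ⇔ Accepts τ s
accepts-≡ s eq = ≡⇒⇔ (cong (λ σ → Accepts σ s) eq)

runs-zeros-[] : ∀ j → runs (replicate (suc j) false ++ []) ≡ (false , suc j) ∷ []
runs-zeros-[] j = trans (cong runs (++-identityʳ (replicate (suc j) false))) (runs-replicate-[] false j)

need-∸-[] : ∀ a j → suc a < suc j ⇔ Accepts (need (suc a ∸ j)) []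
need-∸-[] a j = mk⇔ (λ lt → cong need (m≤n⇒m∸n≡0 (≤-pred lt)))
                    (λ { eq → s≤s (m∸n≡0⇒m≤n (cong-need⁻¹ eq)) })
  where
  cong-need⁻¹ : ∀ {m n} → need m ≡ need n → m ≡ n
  cong-need⁻¹ refl = refl

mutual
  runConstrained-ones-zeros : ∀ a j s →
    RunConstrained (replicate a true ++ replicate (suc j) false ++ s) ⇔ Accepts (need (a ∸ j)) s
  runConstrained-ones-zeros a j (false ∷ s) =
    ⇔-trans (runConstrained-runs (replicate a true ++ replicate (suc j) false ++ false ∷ s)
               (cong (runs ∘ (replicate a true ++_)) (replicate-++-∷ (suc j) false s)))
      (⇔-trans (runConstrained-ones-zeros a (suc j) s) (accepts-≡ s (sym (step-need-false a j))))
  runConstrained-ones-zeros zero j [] =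
    mk⇔ (λ _ → cong need (0∸n≡0 j)) (λ _ → subst RCruns (sym (runs-zeros-[] j)) tt)
  runConstrained-ones-zeros (suc a) j [] =
    ⇔-trans (runConstrained-runs (replicate (suc a) true ++ replicate (suc j) false ++ [])
               (trans (runs-replicate true a _) (cong ((true , suc a) ∷_) (runs-zeros-[] j))))
      (⇔-trans (mk⇔ proj₁ (_, tt)) (need-∸-[] a j))
  runConstrained-ones-zeros zero j (true ∷ s) =
    ⇔-trans (runConstrained-runs (replicate (suc j) false ++ true ∷ s) (runs-replicate false j s))
      (⇔-trans (runConstrained-ones 0 s) (accepts-≡ (true ∷ s) (cong need (sym (0∸n≡0 j)))))
  runConstrained-ones-zeros (suc a) j (true ∷ s) =
    ⇔-trans (runConstrained-runs (replicate (suc a) true ++ replicate (suc j) false ++ true ∷ s)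
               (trans (runs-replicate true a _) (cong ((true , suc a) ∷_) (runs-replicate false j s))))
      (compare-runs (suc a ≤? j))
    where
    compare-runs : Dec (suc a ≤ j) →
      (suc a < suc j × RunConstrained (true ∷ s)) ⇔ Accepts (need (suc a ∸ j)) (true ∷ s)
    compare-runs (yes a<j) = ⇔-trans (mk⇔ proj₂ (s≤s a<j ,_))
      (⇔-trans (runConstrained-ones 0 s) (accepts-≡ (true ∷ s) (cong need (sym (m≤n⇒m∸n≡0 a<j)))))
    compare-runs (no a≮j) = mk⇔ (λ (lt , _) → ⊥-elim (a≮j (≤-pred lt)))
      (λ ok → ⊥-elim (dead-rejects s (subst (λ m → Accepts (need m) (true ∷ s)) (+-∸-assoc 1 (≤-pred (≰⇒> a≮j))) ok)))

  runConstrained-ones : ∀ n s → RunConstrained (replicate (suc n) true ++ s) ⇔ Accepts (ones n) s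
  runConstrained-ones n [] =
    ⇔-trans (runConstrained-runs (replicate (suc n) true ++ [])
               (trans (cong runs (++-identityʳ (replicate (suc n) true))) (runs-replicate-[] true n)))
      (mk⇔ (λ ()) (λ ()))
  runConstrained-ones n (true ∷ s) =
    ⇔-trans (runConstrained-runs (replicate (suc n) true ++ true ∷ s) (cong runs (replicate-++-∷ (suc n) true s)))
      (runConstrained-ones (suc n) s)
  runConstrained-ones n (false ∷ s) = runConstrained-ones-zeros (suc n) 0 s

runConstrained⇔accepts : ∀ s → RunConstrained s ⇔ Accepts (need 0) s
runConstrained⇔accepts []          = mk⇔ (λ _ → refl) (λ _ → tt)
runConstrained⇔accepts (false ∷ s) = runConstrained-ones-zeros 0 0 s
runConstrained⇔accepts (true ∷ s)  = runConstrained-ones 0 s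

LucasRun : List Bool → Set
LucasRun s = CircRunConstrained (s ++ [ false ]) × RunConstrained (s ++ false ∷ false ∷ [])

closing : List Bool → List Bool
closing (false ∷ _) = false ∷ false ∷ []
closing _           = [ false ]

push-++ : ∀ b r M X → push b (r ∷ M ++ X) ≡ push b (r ∷ M) ++ X
push-++ b (c , k) M X with b == c
... | true  = refl
... | false = refl

runs-++-zeros : ∀ u → ∃₂ λ M e → ∀ j → runs (u ++ replicate (suc j) false) ≡ M ++ [ (false , e + suc j) ]
runs-++-zeros [] = [] , 0 , runs-replicate-[] false
runs-++-zeros (b ∷ u) with runs-++-zeros u
... | r ∷ M , e , eq = push b (r ∷ M) , e , λ j → trans (cong (push b) (eq j)) (push-++ b r M _)
runs-++-zeros (false ∷ u) | [] , e , eq = [] , suc e , λ j → cong (push false) (eq j)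
runs-++-zeros (true ∷ u)  | [] , e , eq = [ (true , 1) ] , e , λ j → cong (push true) (eq j)

runs-true∷-zeros : ∀ s → ∃₂ λ k M → ∃ λ e →
  ∀ j → runs (true ∷ s ++ replicate (suc j) false) ≡ (true , k) ∷ M ++ [ (false , e + suc j) ]
runs-true∷-zeros s with runs-++-zeros (true ∷ s) | runs-∷ true (s ++ [ false ])
... | [] , e , eq | k , rs , eq′ with () ← trans (sym (eq 0)) eq′
... | r ∷ M , e , eq | k , rs , eq′ with refl ← trans (sym (eq 0)) eq′ = k , M , e , eq

mergeLast-false : ∀ a E r M → mergeLast (false , a) (r ∷ M ++ [ (false , E) ]) ≡ (false , a + E) ∷ r ∷ M
mergeLast-false a E r []       = refl
mergeLast-false a E r (r′ ∷ M) rewrite mergeLast-false a E r′ M = refl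

mergeLast-true : ∀ a E M → mergeLast (true , a) (M ++ [ (false , E) ]) ≡ (true , a) ∷ M ++ [ (false , E) ]
mergeLast-true a E []            = refl
mergeLast-true a E (r ∷ [])      = refl
mergeLast-true a E (r ∷ r′ ∷ M) rewrite mergeLast-true a E (r′ ∷ M) = refl

circRC-runs : ∀ x {r rs r′ rs′} → runs x ≡ r ∷ rs → mergeLast r rs ≡ r′ ∷ rs′ →
  CircRunConstrained x ⇔ RCcyc r′ (r′ ∷ rs′)
circRC-runs x eq eq′ = via-circRuns (trans (circRuns-runs eq) eq′)
  where
  circRuns-runs : ∀ {r rs} → runs x ≡ r ∷ rs → circRuns x ≡ mergeLast r rs
  circRuns-runs eq rewrite eq = refl
  via-circRuns : ∀ {r′ rs′} → circRuns x ≡ r′ ∷ rs′ → CircRunConstrained x ⇔ RCcyc r′ (r′ ∷ rs′)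
  via-circRuns eq rewrite eq = ⇔-refl

rcCyc-false : ∀ b L → RCcyc (false , b) L ⇔ RCruns (L ++ [ (false , b) ])
rcCyc-false b []                             = mk⇔ _ _
rcCyc-false b ((false , _) ∷ L)              = rcCyc-false b L
rcCyc-false b ((true , a) ∷ [])              = mk⇔ (_, tt) proj₁
rcCyc-false b ((true , a) ∷ (false , c) ∷ L) =
  let ih = rcCyc-false b ((false , c) ∷ L) in
  mk⇔ (λ (lt , rc) → lt , Equivalence.to ih rc) (λ (lt , rc) → lt , Equivalence.from ih rc)
rcCyc-false b ((true , a) ∷ (true , c) ∷ L)  = mk⇔ (λ ()) (λ ())

rcCyc-true : ∀ b L → RCcyc (true , b) L ⇔ RCruns L
rcCyc-true b []                             = mk⇔ _ _
rcCyc-true b ((false , _) ∷ L)              = rcCyc-true b L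
rcCyc-true b ((true , a) ∷ [])              = mk⇔ (λ ()) (λ ())
rcCyc-true b ((true , a) ∷ (false , c) ∷ L) =
  let ih = rcCyc-true b ((false , c) ∷ L) in
  mk⇔ (λ (lt , rc) → lt , Equivalence.to ih rc) (λ (lt , rc) → lt , Equivalence.from ih rc)
rcCyc-true b ((true , a) ∷ (true , c) ∷ L)  = mk⇔ (λ ()) (λ ())

data ZeroPrefix : List Bool → Set where
  all-zeros    : ∀ c → ZeroPrefix (replicate (suc c) false)
  zeros-then-1 : ∀ c s → ZeroPrefix (replicate (suc c) false ++ true ∷ s)

zeroPrefix : ∀ s → ZeroPrefix (false ∷ s)
zeroPrefix []          = all-zeros 0
zeroPrefix (true ∷ s)  = zeros-then-1 0 s
zeroPrefix (false ∷ s) with zeroPrefix s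
... | all-zeros c      = all-zeros (suc c)
... | zeros-then-1 c t = zeros-then-1 (suc c) t

lucasRun-true∷ : ∀ s → LucasRun (true ∷ s) ⇔ Accepts (need 0) (true ∷ s ++ [ false ])
lucasRun-true∷ s with runs-true∷-zeros s
... | k , M , e , eq = mk⇔ (Equivalence.to circ ∘ proj₁)
  (λ ok → Equivalence.from circ ok ,
          Equivalence.from (runConstrained⇔accepts (x ++ false ∷ false ∷ [])) (accepts-++-0⇒00 x ok))
  where
  x : List Bool
  x = true ∷ s
  circ : CircRunConstrained (x ++ [ false ]) ⇔ Accepts (need 0) (x ++ [ false ])
  circ = ⇔-trans (circRC-runs (x ++ [ false ]) (eq 0) (mergeLast-true k (e + 1) M))
    (⇔-trans (rcCyc-true k ((true , k) ∷ M ++ [ (false , e + 1) ]))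
      (⇔-trans (⇔-sym (runConstrained-runs (x ++ [ false ]) (eq 0))) (runConstrained⇔accepts (x ++ [ false ]))))

lucasRun-zeros : ∀ c → let x = replicate (suc c) false in
  LucasRun x ⇔ Accepts (need 0) (x ++ false ∷ false ∷ [])
lucasRun-zeros c = mk⇔ (λ _ → ok) (λ _ → circ , Equivalence.from (runConstrained⇔accepts (x ++ false ∷ false ∷ [])) ok)
  where
  x : List Bool
  x = replicate (suc c) false
  ok : Accepts (need 0) (x ++ false ∷ false ∷ [])
  ok = Equivalence.from (accepts-zeros-++ (suc c) _) refl
  x∷ʳ0 : x ++ [ false ] ≡ replicate (suc (suc c)) false
  x∷ʳ0 = trans (replicate-++-∷ (suc c) false []) (cong (false ∷_) (++-identityʳ _))
  circ : CircRunConstrained (x ++ [ false ])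
  circ = Equivalence.from
    (circRC-runs (x ++ [ false ]) (trans (cong runs x∷ʳ0) (runs-replicate-[] false (suc c))) refl) tt

-- Circularly, the leading zeros of 0^(c+1) 1 s 0 join the final run, as in 1 s 0^(c+2).
lucasRun-zeros-true∷ : ∀ c s → let x = replicate (suc c) false ++ true ∷ s in
  LucasRun x ⇔ Accepts (need 0) (x ++ false ∷ false ∷ [])
lucasRun-zeros-true∷ c s with runs-true∷-zeros s
... | k , M , e , eq =
  mk⇔ (Equivalence.to linear ∘ proj₂) (λ ok → Equivalence.from circ (longer ok) , Equivalence.from linear ok)
  where
  x : List Bool
  x = replicate (suc c) false ++ true ∷ s
  linear : RunConstrained (x ++ false ∷ false ∷ []) ⇔ Accepts (need 0) (x ++ false ∷ false ∷ [])
  linear = runConstrained⇔accepts (x ++ false ∷ false ∷ [])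
  N : ℕ
  N = suc c + (e + 1)
  N≡ : N ≡ e + suc (suc c)
  N≡ = trans (+-comm (suc c) (e + 1)) (+-assoc e 1 (suc c))
  runs-x : runs (x ++ [ false ]) ≡ (false , suc c) ∷ (true , k) ∷ M ++ [ (false , e + 1) ]
  runs-x = trans (cong runs (++-assoc (replicate (suc c) false) (true ∷ s) [ false ]))
                 (trans (runs-replicate false c (s ++ [ false ])) (cong ((false , suc c) ∷_) (eq 0)))
  circ : CircRunConstrained (x ++ [ false ]) ⇔ Accepts (need 0) (true ∷ s ++ replicate (suc (suc c)) false)
  circ = ⇔-trans (circRC-runs (x ++ [ false ]) runs-x (mergeLast-false (suc c) (e + 1) (true , k) M))
    (⇔-trans (rcCyc-false N ((true , k) ∷ M))
      (⇔-trans (⇔-sym (runConstrained-runs (true ∷ s ++ replicate (suc (suc c)) false)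
                                (trans (eq (suc c)) (cong (λ n → (true , k) ∷ M ++ [ (false , n) ]) (sym N≡)))))
        (runConstrained⇔accepts (true ∷ s ++ replicate (suc (suc c)) false))))
  longer : Accepts (need 0) (x ++ false ∷ false ∷ []) → Accepts (need 0) (true ∷ s ++ replicate (suc (suc c)) false)
  longer ok = subst (Accepts (need 0)) (++-assoc (true ∷ s) (false ∷ false ∷ []) (replicate c false))
    (accepts-++-zeros (true ∷ s ++ false ∷ false ∷ []) c
      (Equivalence.to (accepts-zeros-++ (suc c) _)
        (subst (Accepts (need 0)) (++-assoc (replicate (suc c) false) (true ∷ s) _) ok)))

lucasRun⇔accepts : ∀ s → LucasRun s ⇔ Accepts (need 0) (s ++ closing s)
lucasRun⇔accepts []          = mk⇔ (λ _ → refl) (λ _ → tt , tt)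
lucasRun⇔accepts (true ∷ s)  = lucasRun-true∷ s
lucasRun⇔accepts (false ∷ s) = via (zeroPrefix s)
  where
  via : ∀ {x} → ZeroPrefix x → LucasRun x ⇔ Accepts (need 0) (x ++ closing x)
  via (all-zeros c)      = lucasRun-zeros c
  via (zeros-then-1 c t) = lucasRun-zeros-true∷ c t

-- Subcube patterns

data Trit : Set where
  O I X : Trit

data Admits : Trit → Bool → Set where
  O-false : Admits O false
  I-true  : Admits I true
  X-any   : ∀ {b} → Admits X b

admits? : ∀ c b → Dec (Admits c b)
admits? O false = yes O-false
admits? O true  = no λ ()
admits? I true  = yes I-true
admits? I false = no λ ()
admits? X _     = yes X-any

Matches : List Trit → List Bool → Set
Matches = Pointwise Admits

matches? : ∀ p s → Dec (Matches p s)
matches? = Pointwise.decidable admits?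

dim : List Trit → ℕ
dim []      = 0
dim (O ∷ p) = dim p
dim (I ∷ p) = dim p
dim (X ∷ p) = suc (dim p)

bottom : List Trit → ℕ
bottom []      = 0
bottom (O ∷ p) = bottom p
bottom (I ∷ p) = suc (bottom p)
bottom (X ∷ p) = bottom p

matches-++⁻ : ∀ p {q s} → Matches (p ++ q) s → ∃₂ λ s₁ s₂ → s ≡ s₁ ++ s₂ × Matches p s₁ × Matches q s₂
matches-++⁻ []      m       = [] , _ , refl , [] , m
matches-++⁻ (c ∷ p) (a ∷ m) with s₁ , s₂ , refl , m₁ , m₂ ← matches-++⁻ p m = _ ∷ s₁ , s₂ , refl , a ∷ m₁ , m₂

matches-Os : ∀ k {s} → Matches (replicate k O) s → s ≡ replicate k false
matches-Os zero    []            = refl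
matches-Os (suc k) (O-false ∷ m) = cong (false ∷_) (matches-Os k m)

Os-matches : ∀ k → Matches (replicate k O) (replicate k false)
Os-matches zero    = []
Os-matches (suc k) = O-false ∷ Os-matches k

low : Trit → Bool
low I = true
low _ = false

admits-low : ∀ c → Admits c (low c)
admits-low O = O-false
admits-low I = I-true
admits-low X = X-any

lowest-matches : ∀ p → Matches p (map low p)
lowest-matches []      = []
lowest-matches (c ∷ p) = admits-low c ∷ lowest-matches p

admits-injective : ∀ {c c′} → (∀ {b} → Admits c b → Admits c′ b) → (∀ {b} → Admits c′ b → Admits c b) → c ≡ c′
admits-injective {O} {O} _  _    = refl
admits-injective {I} {I} _  _    = refl
admits-injective {X} {X} _  _    = refl
admits-injective {O} {I} to _    with () ← to O-false
admits-injective {O} {X} _  from with () ← from (X-any {true})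
admits-injective {I} {O} to _    with () ← to I-true
admits-injective {I} {X} _  from with () ← from (X-any {false})
admits-injective {X} {O} to _    with () ← to (X-any {true})
admits-injective {X} {I} to _    with () ← to (X-any {false})

matches-injective : ∀ {p p′} → (∀ {s} → Matches p s → Matches p′ s) → (∀ {s} → Matches p′ s → Matches p s) → p ≡ p′
matches-injective {[]}    {[]}      _  _    = refl
matches-injective {[]}    {_ ∷ _}   _  from with () ← from (lowest-matches _)
matches-injective {_ ∷ _} {[]}      to _    with () ← to (lowest-matches _)
matches-injective {c ∷ p} {c′ ∷ p′} to from
  with refl ← admits-injective (λ a → Pointwise.head (to (a ∷ lowest-matches p)))
                               (λ a → Pointwise.head (from (a ∷ lowest-matches p′))) =
  cong (c ∷_) (matches-injective (λ m → Pointwise.tail (to (admits-low c ∷ m)))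
                                 (λ m → Pointwise.tail (from (admits-low c ∷ m))))

-- The pattern automaton

-- A pattern state records the worst string states reached by the matches read so far:
-- all in need m, or all in ones n except, when l holds, some in need n (a final X read as 0).
data PState : Set where
  pneed : ℕ → PState
  pones : ℕ → Bool → PState
  pdead : PState

pstep : PState → Trit → PState
pstep (pneed zero)         O = pneed zero
pstep (pneed zero)         I = pones zero false
pstep (pneed zero)         X = pones zero true
pstep (pneed (suc m))      O = pneed m
pstep (pneed (suc m))      I = pdead
pstep (pneed (suc m))      X = pdead
pstep (pones n l)          O = pneed (suc n)
pstep (pones n false)      I = pones (suc n) false
pstep (pones n false)      X = pones (suc n) true
pstep (pones zero true)    I = pones 1 false
pstep (pones zero true)    X = pones 1 true
pstep (pones (suc n) true) I = pdead
pstep (pones (suc n) true) X = pdead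
pstep pdead                _ = pdead

prun : PState → List Trit → PState
prun = foldl pstep

state : List Trit → PState
state = prun (pneed 0)

AllAccept : PState → List Bool → Set
AllAccept (pneed m)       s = Accepts (need m) s
AllAccept (pones n false) s = Accepts (ones n) s
AllAccept (pones n true)  s = Accepts (ones n) s × Accepts (need n) s
AllAccept pdead           s = ⊥

prun-dead : ∀ p → prun pdead p ≡ pdead
prun-dead []      = refl
prun-dead (_ ∷ p) = prun-dead p

state-++ : ∀ p q → state (p ++ q) ≡ prun (state p) q
state-++ = foldl-++ pstep (pneed 0)

accepts-step-need-false : ∀ n s → Accepts (need (suc n)) s → Accepts (step (need n) false) s
accepts-step-need-false zero    s ok = accepts-need-suc 0 s ok
accepts-step-need-false (suc n) s ok = accepts-need-suc n s (accepts-need-suc (suc n) s ok)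

pstep-sound : ∀ τ c s → (∀ {b} → Admits c b → AllAccept τ (b ∷ s)) ⇔ AllAccept (pstep τ c) s
pstep-sound (pneed zero)         O s = mk⇔ (λ h → h O-false) (λ { ok O-false → ok })
pstep-sound (pneed zero)         I s = mk⇔ (λ h → h I-true) (λ { ok I-true → ok })
pstep-sound (pneed zero)         X s =
  mk⇔ (λ h → h {true} X-any , h {false} X-any) (λ { (a , b) {false} X-any → b ; (a , b) {true} X-any → a })
pstep-sound (pneed (suc m))      O s = mk⇔ (λ h → h O-false) (λ { ok O-false → ok })
pstep-sound (pneed (suc m))      I s = mk⇔ (λ h → dead-rejects s (h I-true)) λ ()
pstep-sound (pneed (suc m))      X s = mk⇔ (λ h → dead-rejects s (h {true} X-any)) λ ()
pstep-sound (pones n false)      O s = mk⇔ (λ h → h O-false) (λ { ok O-false → ok })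
pstep-sound (pones n true)       O s =
  mk⇔ (λ h → proj₁ (h O-false)) (λ { ok O-false → ok , accepts-step-need-false n s ok })
pstep-sound (pones n false)      I s = mk⇔ (λ h → h I-true) (λ { ok I-true → ok })
pstep-sound (pones n false)      X s =
  mk⇔ (λ h → h {true} X-any , h {false} X-any) (λ { (a , b) {false} X-any → b ; (a , b) {true} X-any → a })
pstep-sound (pones zero true)    I s =
  mk⇔ (λ h → proj₁ (h I-true)) (λ { ok I-true → ok , accepts-ones-suc 0 s ok })
pstep-sound (pones zero true)    X s =
  mk⇔ (λ h → proj₁ (h {true} X-any) , proj₁ (h {false} X-any))
      (λ { (a , b) {false} X-any → b , accepts-need-suc 0 s b ; (a , b) {true} X-any → a , accepts-ones-suc 0 s a })
pstep-sound (pones (suc n) true) I s = mk⇔ (λ h → dead-rejects s (proj₂ (h I-true))) λ ()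
pstep-sound (pones (suc n) true) X s = mk⇔ (λ h → dead-rejects s (proj₂ (h {true} X-any))) λ ()
pstep-sound pdead                O s = mk⇔ (λ h → h O-false) λ ()
pstep-sound pdead                I s = mk⇔ (λ h → h I-true) λ ()
pstep-sound pdead                X s = mk⇔ (λ h → h {true} X-any) λ ()

allAccept-[] : ∀ τ → AllAccept τ [] → τ ≡ pneed 0
allAccept-[] (pneed m)       refl     = refl
allAccept-[] (pones n false) ()
allAccept-[] (pones n true)  (() , _)

prun-sound : ∀ p τ → (∀ {s} → Matches p s → AllAccept τ s) ⇔ prun τ p ≡ pneed 0
prun-sound []      τ = mk⇔ (λ h → allAccept-[] τ (h [])) (λ { refl [] → refl })
prun-sound (c ∷ p) τ = mk⇔
  (λ h → Equivalence.to (prun-sound p (pstep τ c)) (λ m → Equivalence.to (pstep-sound τ c _) (λ a → h (a ∷ m))))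
  (λ { eq (a ∷ m) → Equivalence.from (pstep-sound τ c _) (Equivalence.from (prun-sound p (pstep τ c)) eq m) a })

allMatches-++-zeros : ∀ p k →
  (∀ {s} → Matches p s → Accepts (need 0) (s ++ replicate k false)) ⇔ prun (state p) (replicate k O) ≡ pneed 0
allMatches-++-zeros p k = ⇔-trans (mk⇔ to from)
  (⇔-trans (prun-sound (p ++ replicate k O) (pneed 0)) (≡⇒⇔ (cong (_≡ pneed 0) (state-++ p (replicate k O)))))
  where
  Padded Extended : Set
  Padded   = ∀ {s} → Matches p s → Accepts (need 0) (s ++ replicate k false)
  Extended = ∀ {s} → Matches (p ++ replicate k O) s → Accepts (need 0) s
  to : Padded → Extended
  to h m with s₁ , s₂ , refl , m₁ , m₂ ← matches-++⁻ p m rewrite matches-Os k m₂ = h m₁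
  from : Extended → Padded
  from h m = h (Pointwise.++⁺ m (Os-matches k))

Valid : List Trit → Set
Valid p = ∀ {s} → Matches p s → LucasRun s

data Closed : PState → Set where
  settled  : Closed (pneed 0)
  oneShort : Closed (pneed 1)

Wrapped : List Trit → Set
Wrapped p = ∃ λ r → p ≡ O ∷ r × state (r ∷ʳ O) ≡ pneed 1

LucasPattern : List Trit → Set
LucasPattern p = Closed (state p) ⊎ Wrapped p

closed⇔O : ∀ τ → (prun τ [ O ] ≡ pneed 0) ⇔ Closed τ
closed⇔O τ = mk⇔ (to τ) λ { settled → refl ; oneShort → refl }
  where
  to : ∀ τ → prun τ [ O ] ≡ pneed 0 → Closed τ
  to (pneed zero)       _ = settled
  to (pneed (suc zero)) _ = oneShort

closed⇔OO : ∀ τ → (prun τ (O ∷ O ∷ []) ≡ pneed 0) ⇔ (Closed τ ⊎ pstep τ O ≡ pneed 1)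
closed⇔OO τ = mk⇔ (to τ) (from τ)
  where
  to : ∀ τ → prun τ (O ∷ O ∷ []) ≡ pneed 0 → Closed τ ⊎ pstep τ O ≡ pneed 1
  to (pneed zero)             _ = inj₁ settled
  to (pneed (suc zero))       _ = inj₁ oneShort
  to (pneed (suc (suc zero))) _ = inj₂ refl
  to (pones zero l)           _ = inj₂ refl
  from : ∀ τ → Closed τ ⊎ pstep τ O ≡ pneed 1 → prun τ (O ∷ O ∷ []) ≡ pneed 0
  from _ (inj₁ settled)  = refl
  from _ (inj₁ oneShort) = refl
  from τ (inj₂ eq)       = cong (λ σ → pstep σ O) eq

valid⇔accepts : ∀ p → Valid p ⇔ (∀ {s} → Matches p s → Accepts (need 0) (s ++ closing s))
valid⇔accepts p = mk⇔ (λ h {s} m → Equivalence.to (lucasRun⇔accepts s) (h m))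
                      (λ h {s} m → Equivalence.from (lucasRun⇔accepts s) (h m))

not-wrapped : ∀ {c r} → c ≢ O → Closed (state (c ∷ r)) ⇔ LucasPattern (c ∷ r)
not-wrapped c≢O = mk⇔ inj₁ λ { (inj₁ c) → c ; (inj₂ (_ , refl , _)) → ⊥-elim (c≢O refl) }

valid⇔lucasPattern : ∀ p → Valid p ⇔ LucasPattern p
valid⇔lucasPattern [] = mk⇔ (λ _ → inj₁ settled) (λ { _ [] → tt , tt })
valid⇔lucasPattern (O ∷ r) =
  ⇔-trans (valid⇔accepts (O ∷ r))
    (⇔-trans (mk⇔ (λ h {s} m → h (O-false ∷ m)) (λ { h {false ∷ s} (O-false ∷ m) → h m }))
      (⇔-trans (allMatches-++-zeros r 2) (⇔-trans (closed⇔OO (state r)) (mk⇔ to from))))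
  where
  to : Closed (state r) ⊎ pstep (state r) O ≡ pneed 1 → LucasPattern (O ∷ r)
  to (inj₁ c)  = inj₁ c
  to (inj₂ eq) = inj₂ (r , refl , trans (state-++ r [ O ]) eq)
  from : LucasPattern (O ∷ r) → Closed (state r) ⊎ pstep (state r) O ≡ pneed 1
  from (inj₁ c)                 = inj₁ c
  from (inj₂ (_ , refl , eq)) = inj₂ (trans (sym (state-++ r [ O ])) eq)
valid⇔lucasPattern (I ∷ r) =
  ⇔-trans (valid⇔accepts (I ∷ r))
    (⇔-trans (mk⇔ (λ { h {true ∷ s} (I-true ∷ m) → h (I-true ∷ m) })
                  (λ { h {true ∷ s} (I-true ∷ m) → h (I-true ∷ m) }))
      (⇔-trans (allMatches-++-zeros (I ∷ r) 1) (⇔-trans (closed⇔O _) (not-wrapped (λ ())))))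
valid⇔lucasPattern (X ∷ r) =
  ⇔-trans (valid⇔accepts (X ∷ r))
    (⇔-trans (mk⇔ to from)
      (⇔-trans (allMatches-++-zeros (X ∷ r) 1) (⇔-trans (closed⇔O _) (not-wrapped (λ ())))))
  where
  to : (∀ {s} → Matches (X ∷ r) s → Accepts (need 0) (s ++ closing s)) →
       ∀ {s} → Matches (X ∷ r) s → Accepts (need 0) (s ++ [ false ])
  to h {true ∷ s}  m           = h m
  to h {false ∷ s} (X-any ∷ m) = accepts-ones-zero (s ++ [ false ]) (h {true ∷ s} (X-any ∷ m))
  from : (∀ {s} → Matches (X ∷ r) s → Accepts (need 0) (s ++ [ false ])) →
         ∀ {s} → Matches (X ∷ r) s → Accepts (need 0) (s ++ closing s)
  from h {true ∷ s}  m = h m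
  from h {false ∷ s} m = accepts-++-0⇒00 (false ∷ s) (h m)

insertO : List Trit → List Trit
insertO (I ∷ r) = I ∷ insertO r
insertO (X ∷ r) = X ∷ insertO r
insertO r       = O ∷ r

deleteO : List Trit → List Trit
deleteO []      = []
deleteO (O ∷ r) = r
deleteO (I ∷ r) = I ∷ deleteO r
deleteO (X ∷ r) = X ∷ deleteO r

deleteO-insertO : ∀ r → deleteO (insertO r) ≡ r
deleteO-insertO []      = refl
deleteO-insertO (O ∷ r) = refl
deleteO-insertO (I ∷ r) = cong (I ∷_) (deleteO-insertO r)
deleteO-insertO (X ∷ r) = cong (X ∷_) (deleteO-insertO r)

-- Lengthens the leading run of I's and X's by one I (placed second when that run is
-- longer than 1) and the run of O's after it by one O.
widen : List Trit → List Trit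
widen (I ∷ I ∷ r) = I ∷ I ∷ I ∷ insertO r
widen (I ∷ X ∷ r) = I ∷ I ∷ X ∷ insertO r
widen (X ∷ I ∷ r) = X ∷ I ∷ I ∷ insertO r
widen (X ∷ X ∷ r) = X ∷ I ∷ X ∷ insertO r
widen r           = I ∷ insertO r

data Tag : Set where
  base viaO viaWiden viaXOO viaXIOOO viaXXOOO : Tag

encode : Tag → List Trit → List Trit
encode base     r = r
encode viaO     r = O ∷ r
encode viaWiden r = widen r
encode viaXOO   r = X ∷ O ∷ O ∷ r
encode viaXIOOO r = X ∷ I ∷ O ∷ O ∷ O ∷ r
encode viaXXOOO r = X ∷ X ∷ O ∷ O ∷ O ∷ r

growth : Tag → ℕ × ℕ × ℕ
growth base     = 0 , 0 , 0
growth viaO     = 1 , 0 , 0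
growth viaWiden = 2 , 0 , 1
growth viaXOO   = 3 , 1 , 0
growth viaXIOOO = 5 , 1 , 1
growth viaXXOOO = 5 , 2 , 0

data BasePattern : PState → List Trit → Set where
  ε    : BasePattern (pneed 0) []
  IO   : BasePattern (pneed 1) (I ∷ O ∷ [])
  XO   : BasePattern (pneed 1) (X ∷ O ∷ [])
  XIOO : BasePattern (pneed 1) (X ∷ I ∷ O ∷ O ∷ [])
  XXOO : BasePattern (pneed 1) (X ∷ X ∷ O ∷ O ∷ [])

basePattern-state : ∀ {τ p} → BasePattern τ p → state p ≡ τ
basePattern-state ε    = refl
basePattern-state IO   = refl
basePattern-state XO   = refl
basePattern-state XIOO = refl
basePattern-state XXOO = refl

data Decomposition (p : List Trit) : Set where
  base-pattern : BasePattern (state p) p → Decomposition p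
  encoded      : ∀ t r → t ≢ base → p ≡ encode t r → state r ≡ state p → Decomposition p

closed-not-dead : ∀ r → ¬ Closed (prun pdead r)
closed-not-dead r c with prun pdead r | prun-dead r
closed-not-dead r () | _ | refl

after-need1 : ∀ r → Closed (prun (pneed 1) r) → r ≡ [] ⊎ ∃ λ r′ → r ≡ O ∷ r′ × Closed (state r′)
after-need1 []       _ = inj₁ refl
after-need1 (O ∷ r′) c = inj₂ (r′ , refl , c)
after-need1 (I ∷ r′) c = ⊥-elim (closed-not-dead r′ c)
after-need1 (X ∷ r′) c = ⊥-elim (closed-not-dead r′ c)

after-need2 : ∀ r → Closed (prun (pneed 2) r) → r ≡ [ O ] ⊎ ∃ λ r′ → r ≡ O ∷ O ∷ r′ × Closed (state r′)
after-need2 []       ()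
after-need2 (O ∷ r′) c with after-need1 r′ c
... | inj₁ refl            = inj₁ refl
... | inj₂ (r″ , refl , c′) = inj₂ (r″ , refl , c′)
after-need2 (I ∷ r′) c = ⊥-elim (closed-not-dead r′ c)
after-need2 (X ∷ r′) c = ⊥-elim (closed-not-dead r′ c)

prun-insertO : ∀ n l r → Closed (prun (pones (suc n) l) r) →
  prun (pones (suc (suc n)) l) (insertO r) ≡ prun (pones (suc n) l) r
prun-insertO n l     []      ()
prun-insertO n l     (O ∷ r) _ = refl
prun-insertO n false (I ∷ r) c = prun-insertO (suc n) false r c
prun-insertO n false (X ∷ r) c = prun-insertO (suc n) true r c
prun-insertO n true  (I ∷ r) c = ⊥-elim (closed-not-dead r c)
prun-insertO n true  (X ∷ r) c = ⊥-elim (closed-not-dead r c)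

state-widen : ∀ c r → Closed (state (c ∷ r)) → state (widen (c ∷ r)) ≡ state (c ∷ r)
state-widen O r       _ = refl
state-widen I []      ()
state-widen X []      ()
state-widen I (O ∷ r) _ = refl
state-widen X (O ∷ r) _ = refl
state-widen I (I ∷ r) c = prun-insertO 0 false r c
state-widen I (X ∷ r) c = prun-insertO 0 true r c
state-widen X (I ∷ r) c = prun-insertO 0 false r c
state-widen X (X ∷ r) c = prun-insertO 0 true r c

unwiden : ∀ n l r → Closed (prun (pones (suc (suc n)) l) r) →
  insertO (deleteO r) ≡ r × prun (pones (suc n) l) (deleteO r) ≡ prun (pones (suc (suc n)) l) r
unwiden n l     []           ()
unwiden n l     (O ∷ [])     ()
unwiden n l     (O ∷ O ∷ r)  _ = refl , refl
unwiden n l     (O ∷ I ∷ r)  c = ⊥-elim (closed-not-dead r c)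
unwiden n l     (O ∷ X ∷ r)  c = ⊥-elim (closed-not-dead r c)
unwiden n true  (I ∷ r)      c = ⊥-elim (closed-not-dead r c)
unwiden n true  (X ∷ r)      c = ⊥-elim (closed-not-dead r c)
unwiden n false (I ∷ r)      c with e₁ , e₂ ← unwiden (suc n) false r c = cong (I ∷_) e₁ , e₂
unwiden n false (X ∷ r)      c with e₁ , e₂ ← unwiden (suc n) true r c = cong (X ∷_) e₁ , e₂

-- A leading run beginning y I c (y, c ∈ {I, X}) is the widening of that run without this I.
decompose-long : ∀ {y c l} r →
  (∀ z → widen (y ∷ c ∷ z) ≡ y ∷ I ∷ c ∷ insertO z) →
  (∀ z → state (y ∷ c ∷ z) ≡ prun (pones 1 l) z) →
  (∀ z → state (y ∷ I ∷ c ∷ z) ≡ prun (pones 2 l) z) →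
  Closed (state (y ∷ I ∷ c ∷ r)) → Decomposition (y ∷ I ∷ c ∷ r)
decompose-long {y} {c} {l} r widen-yc state-yc state-yIc closed
  with inserted , same-state ← unwiden 0 l r (subst Closed (state-yIc r) closed) =
  encoded viaWiden (y ∷ c ∷ deleteO r) (λ ())
    (sym (trans (widen-yc (deleteO r)) (cong (λ z → y ∷ I ∷ c ∷ z) inserted)))
    (trans (state-yc (deleteO r)) (trans same-state (sym (state-yIc r))))

decompose : ∀ p → Closed (state p) → Decomposition p
decompose [] _ = base-pattern ε
decompose (O ∷ r) _ = encoded viaO r (λ ()) refl refl
decompose (I ∷ []) ()
decompose (X ∷ []) ()
decompose (I ∷ O ∷ r) c with after-need1 r c
... | inj₁ refl            = base-pattern IO
... | inj₂ (r′ , refl , _) = encoded viaWiden (O ∷ r′) (λ ()) refl refl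
decompose (X ∷ O ∷ r) c with after-need1 r c
... | inj₁ refl            = base-pattern XO
... | inj₂ (r′ , refl , _) = encoded viaXOO r′ (λ ()) refl refl
decompose (I ∷ I ∷ []) ()
decompose (I ∷ X ∷ []) ()
decompose (X ∷ I ∷ []) ()
decompose (X ∷ X ∷ []) ()
decompose (I ∷ I ∷ O ∷ r) c with after-need2 r c
... | inj₁ refl            = encoded viaWiden (I ∷ O ∷ []) (λ ()) refl refl
... | inj₂ (r′ , refl , _) = encoded viaWiden (I ∷ O ∷ O ∷ r′) (λ ()) refl refl
decompose (I ∷ X ∷ O ∷ r) c with after-need2 r c
... | inj₁ refl            = encoded viaWiden (X ∷ O ∷ []) (λ ()) refl refl
... | inj₂ (r′ , refl , _) = encoded viaWiden (X ∷ O ∷ O ∷ r′) (λ ()) refl refl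
decompose (X ∷ I ∷ O ∷ r) c with after-need2 r c
... | inj₁ refl            = base-pattern XIOO
... | inj₂ (r′ , refl , _) = encoded viaXIOOO r′ (λ ()) refl refl
decompose (X ∷ X ∷ O ∷ r) c with after-need2 r c
... | inj₁ refl            = base-pattern XXOO
... | inj₂ (r′ , refl , _) = encoded viaXXOOO r′ (λ ()) refl refl
decompose (I ∷ I ∷ I ∷ r) c = decompose-long r (λ _ → refl) (λ _ → refl) (λ _ → refl) c
decompose (I ∷ I ∷ X ∷ r) c = decompose-long r (λ _ → refl) (λ _ → refl) (λ _ → refl) c
decompose (X ∷ I ∷ I ∷ r) c = decompose-long r (λ _ → refl) (λ _ → refl) (λ _ → refl) c
decompose (X ∷ I ∷ X ∷ r) c = decompose-long r (λ _ → refl) (λ _ → refl) (λ _ → refl) c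
decompose (I ∷ X ∷ I ∷ r) c = ⊥-elim (closed-not-dead r c)
decompose (I ∷ X ∷ X ∷ r) c = ⊥-elim (closed-not-dead r c)
decompose (X ∷ X ∷ I ∷ r) c = ⊥-elim (closed-not-dead r c)
decompose (X ∷ X ∷ X ∷ r) c = ⊥-elim (closed-not-dead r c)

Stats : List Trit → ℕ × ℕ × ℕ
Stats p = length p , dim p , bottom p

_⊕_ : ℕ × ℕ × ℕ → ℕ × ℕ × ℕ → ℕ × ℕ × ℕ
(a , b , c) ⊕ (a′ , b′ , c′) = a + a′ , b + b′ , c + c′

stats-∷ : ∀ c x y → Stats x ≡ Stats y → Stats (c ∷ x) ≡ Stats (c ∷ y)
stats-∷ O _ _ = cong λ (l , k , d) → suc l , k , d
stats-∷ I _ _ = cong λ (l , k , d) → suc l , k , suc d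
stats-∷ X _ _ = cong λ (l , k , d) → suc l , suc k , d

stats-swap : ∀ a b x → Stats (a ∷ b ∷ x) ≡ Stats (b ∷ a ∷ x)
stats-swap O O x = refl
stats-swap O I x = refl
stats-swap O X x = refl
stats-swap I O x = refl
stats-swap I I x = refl
stats-swap I X x = refl
stats-swap X O x = refl
stats-swap X I x = refl
stats-swap X X x = refl

stats-∷ʳ : ∀ r c → Stats (r ∷ʳ c) ≡ Stats (c ∷ r)
stats-∷ʳ []      c = refl
stats-∷ʳ (a ∷ r) c = trans (stats-∷ a (r ∷ʳ c) (c ∷ r) (stats-∷ʳ r c)) (stats-swap a c r)

stats-insertO : ∀ r → Stats (insertO r) ≡ Stats (O ∷ r)
stats-insertO []      = refl
stats-insertO (O ∷ r) = refl
stats-insertO (I ∷ r) = trans (stats-∷ I (insertO r) (O ∷ r) (stats-insertO r)) (stats-swap I O r)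
stats-insertO (X ∷ r) = trans (stats-∷ X (insertO r) (O ∷ r) (stats-insertO r)) (stats-swap X O r)

stats-I∷insertO : ∀ r → Stats (I ∷ insertO r) ≡ Stats (I ∷ O ∷ r)
stats-I∷insertO r = stats-∷ I (insertO r) (O ∷ r) (stats-insertO r)

stats-widen : ∀ r → Stats (widen r) ≡ Stats (I ∷ O ∷ r)
stats-widen (I ∷ I ∷ r) = stats-I∷insertO (I ∷ I ∷ r)
stats-widen (I ∷ X ∷ r) = stats-I∷insertO (I ∷ X ∷ r)
stats-widen (X ∷ I ∷ r) = trans (stats-swap X I (I ∷ insertO r)) (stats-I∷insertO (X ∷ I ∷ r))
stats-widen (X ∷ X ∷ r) = trans (stats-swap X I (X ∷ insertO r)) (stats-I∷insertO (X ∷ X ∷ r))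
stats-widen []          = refl
stats-widen (O ∷ r)     = refl
stats-widen (I ∷ [])    = refl
stats-widen (I ∷ O ∷ r) = refl
stats-widen (X ∷ [])    = refl
stats-widen (X ∷ O ∷ r) = refl

stats-encode : ∀ t r → Stats (encode t r) ≡ growth t ⊕ Stats r
stats-encode base     r = refl
stats-encode viaO     r = refl
stats-encode viaWiden r = stats-widen r
stats-encode viaXOO   r = refl
stats-encode viaXIOOO r = refl
stats-encode viaXXOOO r = refl

-- A left inverse of the encodings, on closed patterns.
decode : List Trit → Tag × List Trit
decode (O ∷ r)                 = viaO , r
decode (I ∷ O ∷ O ∷ r)         = viaWiden , O ∷ r
decode (I ∷ I ∷ O ∷ O ∷ r)     = viaWiden , I ∷ O ∷ r
decode (I ∷ X ∷ O ∷ O ∷ r)     = viaWiden , X ∷ O ∷ r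
decode (I ∷ I ∷ I ∷ r)         = viaWiden , I ∷ I ∷ deleteO r
decode (I ∷ I ∷ X ∷ r)         = viaWiden , I ∷ X ∷ deleteO r
decode (X ∷ I ∷ I ∷ r)         = viaWiden , X ∷ I ∷ deleteO r
decode (X ∷ I ∷ X ∷ r)         = viaWiden , X ∷ X ∷ deleteO r
decode (X ∷ O ∷ O ∷ r)         = viaXOO , r
decode (X ∷ I ∷ O ∷ O ∷ O ∷ r) = viaXIOOO , r
decode (X ∷ X ∷ O ∷ O ∷ O ∷ r) = viaXXOOO , r
decode p                       = base , p

decode-base : ∀ {τ p} → BasePattern τ p → decode p ≡ (base , p)
decode-base ε    = refl
decode-base IO   = refl
decode-base XO   = refl
decode-base XIOO = refl
decode-base XXOO = refl

decode-widen : ∀ c r → Closed (state (c ∷ r)) → decode (widen (c ∷ r)) ≡ (viaWiden , c ∷ r)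
decode-widen O r       _  = refl
decode-widen I []      ()
decode-widen X []      ()
decode-widen I (O ∷ r) _  = refl
decode-widen X (O ∷ r) _  = refl
decode-widen I (I ∷ r) _  = cong (λ z → viaWiden , I ∷ I ∷ z) (deleteO-insertO r)
decode-widen I (X ∷ r) _  = cong (λ z → viaWiden , I ∷ X ∷ z) (deleteO-insertO r)
decode-widen X (I ∷ r) _  = cong (λ z → viaWiden , X ∷ I ∷ z) (deleteO-insertO r)
decode-widen X (X ∷ r) _  = cong (λ z → viaWiden , X ∷ X ∷ z) (deleteO-insertO r)

HasShape : ℕ → ℕ → List Trit → Set
HasShape k d p = dim p ≡ k × bottom p ≡ d

hasShape? : ∀ k d → Decidable (HasShape k d)
hasShape? k d p = (dim p ≟ k) ×-dec (bottom p ≟ d)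

count : ℕ → ℕ → List (List Trit) → ℕ
count k d ps = length (filter (hasShape? k d) ps)

count-map : ∀ (f : List Trit → List Trit) a i k d xs →
  (∀ {x} → x ∈ xs → dim (f x) ≡ a + dim x × bottom (f x) ≡ i + bottom x) →
  count k d (map f xs) ≡ (if (a ≤ᵇ k) ∧ (i ≤ᵇ d) then count (k ∸ a) (d ∸ i) xs else 0)
count-map f a i k d xs shifts = length-filter-map (hasShape? k d) (hasShape? (k ∸ a) (d ∸ i)) f _ xs shape
  where
  shape : ∀ {x} → x ∈ xs → does (hasShape? k d (f x)) ≡ ((a ≤ᵇ k) ∧ (i ≤ᵇ d)) ∧ does (hasShape? (k ∸ a) (d ∸ i) x)
  shape {x} m rewrite proj₁ (shifts m) | proj₂ (shifts m) | +-≡ᵇ a (dim x) k | +-≡ᵇ i (bottom x) d =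
    ∧-interchange (a ≤ᵇ k) (dim x ≡ᵇ k ∸ a) (i ≤ᵇ d) (bottom x ≡ᵇ d ∸ i)

-- Generating the closed patterns of a given state

steps : List Tag
steps = viaO ∷ viaWiden ∷ viaXOO ∷ viaXIOOO ∷ viaXXOOO ∷ []

tags : List Tag
tags = base ∷ steps

tags-unique : Unique tags
tags-unique = ((λ ()) ∷ (λ ()) ∷ (λ ()) ∷ (λ ()) ∷ (λ ()) ∷ [])
            ∷ ((λ ()) ∷ (λ ()) ∷ (λ ()) ∷ (λ ()) ∷ [])
            ∷ ((λ ()) ∷ (λ ()) ∷ (λ ()) ∷ [])
            ∷ ((λ ()) ∷ (λ ()) ∷ [])
            ∷ ((λ ()) ∷ [])
            ∷ [] ∷ []

∈-tags : ∀ t → t ∈ tags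
∈-tags base     = here refl
∈-tags viaO     = there (here refl)
∈-tags viaWiden = there (there (here refl))
∈-tags viaXOO   = there (there (there (here refl)))
∈-tags viaXIOOO = there (there (there (there (here refl))))
∈-tags viaXXOOO = there (there (there (there (there (here refl)))))

Δlength Δdim Δbottom : Tag → ℕ
Δlength t = proj₁ (growth t)
Δdim    t = proj₁ (proj₂ (growth t))
Δbottom t = proj₂ (proj₂ (growth t))

encode-shifts : ∀ t r → dim (encode t r) ≡ Δdim t + dim r × bottom (encode t r) ≡ Δbottom t + bottom r
encode-shifts t r = cong (proj₁ ∘ proj₂) (stats-encode t r) , cong (proj₂ ∘ proj₂) (stats-encode t r)

stepSum : (ℕ → ℕ → ℕ → ℕ) → ℕ → ℕ → ℕ → ℕ
stepSum F n k d = sum (map (λ t → shift F (Δlength t) (Δdim t) (Δbottom t) n k d) steps)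

encode-longer : ∀ t r → t ≢ base → length r < length (encode t r)
encode-longer base     r t≢base = ⊥-elim (t≢base refl)
encode-longer viaO     r _      = n<1+n (length r)
encode-longer viaWiden r _      = subst (length r <_) (sym (cong proj₁ (stats-widen r))) (m<n+m (length r) (s≤s z≤n))
encode-longer viaXOO   r _      = m<n+m (length r) (s≤s z≤n)
encode-longer viaXIOOO r _      = m<n+m (length r) (s≤s z≤n)
encode-longer viaXXOOO r _      = m<n+m (length r) (s≤s z≤n)

module Generator
  (target    : PState)
  (closed    : Closed target)
  (baseList  : ℕ → List (List Trit))
  (base-sound    : ∀ {n p} → p ∈ baseList n → length p ≡ n × BasePattern target p)
  (base-complete : ∀ {p} → BasePattern target p → p ∈ baseList (length p))
  (base-unique   : ∀ n → Unique (baseList n))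
  where

  mutual
    generate : ℕ → List (List Trit)
    generate zero    = baseList zero
    generate (suc n) = concatMap (λ t → map (encode t) (source t n)) tags

    -- the patterns r with encode t r of length n + 1; the empty pattern is never widened
    source : Tag → ℕ → List (List Trit)
    source base     n             = baseList (suc n)
    source viaO     n             = generate n
    source viaWiden (suc (suc n)) = generate (suc n)
    source viaWiden _             = []
    source viaXOO   n             = earlier 2 n
    source viaXIOOO n             = earlier 4 n
    source viaXXOOO n             = earlier 4 n

    earlier : ℕ → ℕ → List (List Trit)
    earlier zero    n       = generate n
    earlier (suc j) zero    = []
    earlier (suc j) (suc n) = earlier j n

  mutual
    generate-sound : ∀ n {p} → p ∈ generate n → length p ≡ n × state p ≡ target
    generate-sound zero    m = let l , b = base-sound m in l , basePattern-state b
    generate-sound (suc n) m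
      with t , _ , m′ ← find (∈-concatMap⁻ (λ t → map (encode t) (source t n)) {xs = tags} m)
      with r , r∈ , refl ← ∈-map⁻ (encode t) m′ = source-sound t n r∈

    source-sound : ∀ t n {r} → r ∈ source t n → length (encode t r) ≡ suc n × state (encode t r) ≡ target
    source-sound base     n m = let l , b = base-sound m in l , basePattern-state b
    source-sound viaO     n m = let l , s = generate-sound n m in cong suc l , s
    source-sound viaWiden (suc (suc n)) {[]} m with () ← proj₁ (generate-sound (suc n) m)
    source-sound viaWiden (suc (suc n)) {c ∷ r} m =
      let l , s = generate-sound (suc n) m
          closed′ = subst Closed (sym s) closed
      in trans (cong proj₁ (stats-widen (c ∷ r))) (cong (λ m → suc (suc m)) l) , trans (state-widen c r closed′) s
    source-sound viaXOO   n m = let l , s = earlier-sound 2 n m in cong suc l , s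
    source-sound viaXIOOO n m = let l , s = earlier-sound 4 n m in cong suc l , s
    source-sound viaXXOOO n m = let l , s = earlier-sound 4 n m in cong suc l , s

    earlier-sound : ∀ j n {r} → r ∈ earlier j n → j + length r ≡ n × state r ≡ target
    earlier-sound zero    n       m = generate-sound n m
    earlier-sound (suc j) (suc n) m = let l , s = earlier-sound j n m in cong suc l , s

  ∈-generate : ∀ t {n r} → r ∈ source t n → encode t r ∈ generate (suc n)
  ∈-generate t {n} m = ∈-concat⁺′ (∈-map⁺ (encode t) m) (∈-map⁺ (λ t → map (encode t) (source t n)) (∈-tags t))

  encode-∈-generate : ∀ t {r} → t ≢ base → state r ≡ state (encode t r) →
    r ∈ generate (length r) → encode t r ∈ generate (length (encode t r))
  encode-∈-generate base     t≢base _ _ = ⊥-elim (t≢base refl)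
  encode-∈-generate viaO     _ _ m = ∈-generate viaO m
  encode-∈-generate viaWiden {[]}    _ () _
  encode-∈-generate viaWiden {c ∷ r} _ _ m =
    subst (λ n → widen (c ∷ r) ∈ generate n) (sym (cong proj₁ (stats-widen (c ∷ r)))) (∈-generate viaWiden m)
  encode-∈-generate viaXOO   _ _ m = ∈-generate viaXOO m
  encode-∈-generate viaXIOOO _ _ m = ∈-generate viaXIOOO m
  encode-∈-generate viaXXOOO _ _ m = ∈-generate viaXXOOO m

  base-∈-generate : ∀ {p} → p ∈ baseList (length p) → p ∈ generate (length p)
  base-∈-generate {p} m with length p
  ... | zero  = m
  ... | suc n = ∈-generate base m

  generate-complete : ∀ p → state p ≡ target → p ∈ generate (length p)
  generate-complete p = go p (<-wellFounded (length p))
    where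
    go : ∀ p → Acc _<_ (length p) → state p ≡ target → p ∈ generate (length p)
    go p (acc smaller) s with decompose p (subst Closed (sym s) closed)
    ... | base-pattern b = base-∈-generate (base-complete (subst (λ τ → BasePattern τ p) s b))
    ... | encoded t r t≢base refl s′ =
      encode-∈-generate t t≢base s′ (go r (smaller (encode-longer t r t≢base)) (trans s′ s))

  decodes : ∀ n t {r} → r ∈ source t n → decode (encode t r) ≡ (t , r)
  decodes n             base     m = decode-base (proj₂ (base-sound m))
  decodes n             viaO     m = refl
  decodes (suc (suc n)) viaWiden {[]}    m with () ← proj₁ (generate-sound (suc n) m)
  decodes (suc (suc n)) viaWiden {c ∷ r} m =
    decode-widen c r (subst Closed (sym (proj₂ (generate-sound (suc n) m))) closed)
  decodes n             viaXOO   m = refl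
  decodes n             viaXIOOO m = refl
  decodes n             viaXXOOO m = refl

  mutual
    generate-unique : ∀ n → Unique (generate n)
    generate-unique zero    = base-unique 0
    generate-unique (suc n) =
      Unique-concatMap-images encode decode (λ t → source t n) tags-unique (λ t → source-unique t n) (decodes n)

    source-unique : ∀ t n → Unique (source t n)
    source-unique base     n             = base-unique (suc n)
    source-unique viaO     n             = generate-unique n
    source-unique viaWiden zero          = []
    source-unique viaWiden (suc zero)    = []
    source-unique viaWiden (suc (suc n)) = generate-unique (suc n)
    source-unique viaXOO   n             = earlier-unique 2 n
    source-unique viaXIOOO n             = earlier-unique 4 n
    source-unique viaXXOOO n             = earlier-unique 4 n

    earlier-unique : ∀ j n → Unique (earlier j n)
    earlier-unique zero    n       = generate-unique n
    earlier-unique (suc j) zero    = []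
    earlier-unique (suc j) (suc n) = earlier-unique j n

  coefficient : ℕ → ℕ → ℕ → ℕ
  coefficient n k d = count k d (generate n)

  earlier-if : ∀ j n → earlier j n ≡ (if j ≤ᵇ n then generate (n ∸ j) else [])
  earlier-if zero    n       = refl
  earlier-if (suc j) zero    = refl
  earlier-if (suc j) (suc n) = trans (earlier-if j n) (cong (if_then generate (n ∸ j) else []) (sym (≤ᵇ-suc j n)))

  source-widen : ∀ n → n ≢ 1 → source viaWiden n ≡ (if 2 ≤ᵇ suc n then generate (suc n ∸ 2) else [])
  source-widen zero          _   = refl
  source-widen (suc zero)    n≢1 = ⊥-elim (n≢1 refl)
  source-widen (suc (suc n)) _   = refl

  count-source : ∀ t n k d → source t n ≡ (if Δlength t ≤ᵇ suc n then generate (suc n ∸ Δlength t) else []) →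
    count k d (map (encode t) (source t n)) ≡ shift coefficient (Δlength t) (Δdim t) (Δbottom t) (suc n) k d
  count-source t n k d eq
    rewrite count-map (encode t) (Δdim t) (Δbottom t) k d (source t n) (λ {x} _ → encode-shifts t x) | eq
    with Δlength t ≤ᵇ suc n | (Δdim t ≤ᵇ k) ∧ (Δbottom t ≤ᵇ d)
  ... | true  | _     = refl
  ... | false | true  = refl
  ... | false | false = refl

  coefficient-suc : ∀ n k d → n ≢ 1 →
    coefficient (suc n) k d ≡ count k d (baseList (suc n)) + stepSum coefficient (suc n) k d
  coefficient-suc n k d n≢1 =
    trans (length-filter-concat (hasShape? k d) (map (λ t → map (encode t) (source t n)) tags))
      (cong₂ _+_ (cong (count k d) (map-id (baseList (suc n))))
        (cong sum (map-cong-local {f = λ t → count k d (map (encode t) (source t n))}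
                                   {g = λ t → shift coefficient (Δlength t) (Δdim t) (Δbottom t) (suc n) k d}
                                   {xs = steps}
          ( count-source viaO n k d refl
          ∷ count-source viaWiden n k d (source-widen n n≢1)
          ∷ count-source viaXOO n k d (earlier-if 2 n)
          ∷ count-source viaXIOOO n k d (earlier-if 4 n)
          ∷ count-source viaXXOOO n k d (earlier-if 4 n) ∷ []))))

closed-cases : ∀ {τ} → Closed τ → τ ≡ pneed 0 ⊎ τ ≡ pneed 1
closed-cases settled  = inj₁ refl
closed-cases oneShort = inj₂ refl

baseSettled : ℕ → List (List Trit)
baseSettled zero    = [ [] ]
baseSettled (suc _) = []

baseSettled-sound : ∀ {n p} → p ∈ baseSettled n → length p ≡ n × BasePattern (pneed 0) p
baseSettled-sound {zero} (here refl) = refl , ε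

baseSettled-complete : ∀ {p} → BasePattern (pneed 0) p → p ∈ baseSettled (length p)
baseSettled-complete ε = here refl

baseSettled-unique : ∀ n → Unique (baseSettled n)
baseSettled-unique zero    = [] ∷ []
baseSettled-unique (suc _) = []

baseOneShort : ℕ → List (List Trit)
baseOneShort 2 = (I ∷ O ∷ []) ∷ (X ∷ O ∷ []) ∷ []
baseOneShort 4 = (X ∷ I ∷ O ∷ O ∷ []) ∷ (X ∷ X ∷ O ∷ O ∷ []) ∷ []
baseOneShort _ = []

baseOneShort-sound : ∀ {n p} → p ∈ baseOneShort n → length p ≡ n × BasePattern (pneed 1) p
baseOneShort-sound {2} (here refl)         = refl , IO
baseOneShort-sound {2} (there (here refl)) = refl , XO
baseOneShort-sound {4} (here refl)         = refl , XIOO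
baseOneShort-sound {4} (there (here refl)) = refl , XXOO

baseOneShort-complete : ∀ {p} → BasePattern (pneed 1) p → p ∈ baseOneShort (length p)
baseOneShort-complete IO   = here refl
baseOneShort-complete XO   = there (here refl)
baseOneShort-complete XIOO = here refl
baseOneShort-complete XXOO = there (here refl)

baseOneShort-unique : ∀ n → Unique (baseOneShort n)
baseOneShort-unique 0                               = []
baseOneShort-unique 1                               = []
baseOneShort-unique 2                               = ((λ ()) ∷ []) ∷ [] ∷ []
baseOneShort-unique 3                               = []
baseOneShort-unique 4                               = ((λ ()) ∷ []) ∷ [] ∷ []
baseOneShort-unique (suc (suc (suc (suc (suc _))))) = []

module Settled = Generator (pneed 0) settled baseSettled
  baseSettled-sound baseSettled-complete baseSettled-unique
module OneShort = Generator (pneed 1) oneShort baseOneShort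
  baseOneShort-sound baseOneShort-complete baseOneShort-unique

pstep≡pneed1 : ∀ τ c → pstep τ c ≡ pneed 1 → c ≡ O
pstep≡pneed1 τ                    O _  = refl
pstep≡pneed1 (pneed zero)         I ()
pstep≡pneed1 (pneed zero)         X ()
pstep≡pneed1 (pneed (suc m))      I ()
pstep≡pneed1 (pneed (suc m))      X ()
pstep≡pneed1 (pones n false)      I ()
pstep≡pneed1 (pones n false)      X ()
pstep≡pneed1 (pones zero true)    I ()
pstep≡pneed1 (pones zero true)    X ()
pstep≡pneed1 (pones (suc n) true) I ()
pstep≡pneed1 (pones (suc n) true) X ()
pstep≡pneed1 pdead                I ()
pstep≡pneed1 pdead                X ()

oneShort-∷ʳ : ∀ x → state x ≡ pneed 1 → ∃ λ r → x ≡ r ∷ʳ O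
oneShort-∷ʳ x s with initLast x
... | []      with () ← s
... | r ∷ʳ′ c = r , cong (r ∷ʳ_) (pstep≡pneed1 (state r) c (trans (sym (foldl-∷ʳ pstep (pneed 0) c r)) s))

-- Wrapped patterns are the rotations of one-short ones.
rotate : List Trit → List Trit
rotate x = O ∷ dropLast x

wrapped : ℕ → List (List Trit)
wrapped n = map rotate (OneShort.generate n)

rotate-∷ʳ : ∀ r → rotate (r ∷ʳ O) ≡ O ∷ r
rotate-∷ʳ r = cong (O ∷_) (dropLast-∷ʳ r O)

wrapped-sound : ∀ n {p} → p ∈ wrapped n → length p ≡ n × Wrapped p
wrapped-sound n m with x , x∈ , refl ← ∈-map⁻ rotate m = sound x (OneShort.generate-sound n x∈)
  where
  sound : ∀ x → length x ≡ n × state x ≡ pneed 1 → length (rotate x) ≡ n × Wrapped (rotate x)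
  sound x (l , s) with r , refl ← oneShort-∷ʳ x s =
    subst (λ q → length q ≡ n × Wrapped q) (sym (rotate-∷ʳ r))
      (trans (cong proj₁ (sym (stats-∷ʳ r O))) l , r , refl , s)

wrapped-complete : ∀ {p} → Wrapped p → p ∈ wrapped (length p)
wrapped-complete (r , refl , s) =
  subst₂ (λ q n → q ∈ wrapped n) (rotate-∷ʳ r) (cong proj₁ (stats-∷ʳ r O))
    (∈-map⁺ rotate (OneShort.generate-complete (r ∷ʳ O) s))

wrapped-unique : ∀ n → Unique (wrapped n)
wrapped-unique n = Unique-map⁺-local rotate (OneShort.generate-unique n) injective
  where
  ends-with-O : ∀ {x} → x ∈ OneShort.generate n → ∃ λ r → x ≡ r ∷ʳ O
  ends-with-O {x} m = oneShort-∷ʳ x (proj₂ (OneShort.generate-sound n m))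
  injective : ∀ {x y} → x ∈ OneShort.generate n → y ∈ OneShort.generate n → rotate x ≡ rotate y → x ≡ y
  injective mx my eq with r , refl ← ends-with-O mx | r′ , refl ← ends-with-O my =
    cong (_∷ʳ O) (∷-injectiveʳ (trans (sym (rotate-∷ʳ r)) (trans eq (rotate-∷ʳ r′))))

count-wrapped : ∀ n k d → count k d (wrapped n) ≡ OneShort.coefficient n k d
count-wrapped n k d = count-map rotate 0 0 k d (OneShort.generate n) shifts
  where
  shifts : ∀ {x} → x ∈ OneShort.generate n → dim (rotate x) ≡ dim x × bottom (rotate x) ≡ bottom x
  shifts {x} m with r , refl ← oneShort-∷ʳ x (proj₂ (OneShort.generate-sound n m)) =
    let same = trans (cong Stats (rotate-∷ʳ r)) (sym (stats-∷ʳ r O)) in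
    cong (proj₁ ∘ proj₂) same , cong (proj₂ ∘ proj₂) same

wrapped-not-closed : ∀ {p} → Wrapped p → ¬ Closed (state p)
wrapped-not-closed (r , refl , s) c
  with () ← trans (sym (Equivalence.from (closed⇔O (state r)) c)) (trans (sym (state-++ r [ O ])) s)

lucasPatterns : ℕ → List (List Trit)
lucasPatterns n = Settled.generate n ++ OneShort.generate n ++ wrapped n

lucasPatterns-sound : ∀ n {p} → p ∈ lucasPatterns n → length p ≡ n × LucasPattern p
lucasPatterns-sound n m with ∈-++⁻ (Settled.generate n) m
... | inj₁ m₀ = let l , s = Settled.generate-sound n m₀ in l , inj₁ (subst Closed (sym s) settled)
... | inj₂ m′ with ∈-++⁻ (OneShort.generate n) m′
...   | inj₁ m₁ = let l , s = OneShort.generate-sound n m₁ in l , inj₁ (subst Closed (sym s) oneShort)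
...   | inj₂ m₂ = let l , w = wrapped-sound n m₂ in l , inj₂ w

lucasPatterns-complete : ∀ {p} → LucasPattern p → p ∈ lucasPatterns (length p)
lucasPatterns-complete {p} (inj₁ c) with closed-cases c
... | inj₁ s = ∈-++⁺ˡ (Settled.generate-complete p s)
... | inj₂ s = ∈-++⁺ʳ (Settled.generate (length p)) (∈-++⁺ˡ (OneShort.generate-complete p s))
lucasPatterns-complete {p} (inj₂ w) =
  ∈-++⁺ʳ (Settled.generate (length p)) (∈-++⁺ʳ (OneShort.generate (length p)) (wrapped-complete w))

lucasPatterns-unique : ∀ n → Unique (lucasPatterns n)
lucasPatterns-unique n =
  Unique.++⁺ (Settled.generate-unique n)
    (Unique.++⁺ (OneShort.generate-unique n) (wrapped-unique n) oneShort-not-wrapped)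
    settled-not-other
  where
  oneShort-not-wrapped : ∀ {p} → p ∈ OneShort.generate n × p ∈ wrapped n → ⊥
  oneShort-not-wrapped (m₁ , m₂) =
    wrapped-not-closed (proj₂ (wrapped-sound n m₂)) (subst Closed (sym (proj₂ (OneShort.generate-sound n m₁))) oneShort)
  settled-not-other : ∀ {p} → p ∈ Settled.generate n × p ∈ OneShort.generate n ++ wrapped n → ⊥
  settled-not-other (m₀ , m) with ∈-++⁻ (OneShort.generate n) m
  ... | inj₁ m₁ with () ← trans (sym (proj₂ (Settled.generate-sound n m₀))) (proj₂ (OneShort.generate-sound n m₁))
  ... | inj₂ m₂ =
    wrapped-not-closed (proj₂ (wrapped-sound n m₂)) (subst Closed (sym (proj₂ (Settled.generate-sound n m₀))) settled)

-- The generating function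

coefficient : ℕ → ℕ → ℕ → ℕ
coefficient n k d = count k d (lucasPatterns n)

coefficient-split : ∀ n k d →
  coefficient n k d ≡ Settled.coefficient n k d + (OneShort.coefficient n k d + OneShort.coefficient n k d)
coefficient-split n k d =
  trans (length-filter-++ (hasShape? k d) (Settled.generate n) _)
    (cong (Settled.coefficient n k d +_)
      (trans (length-filter-++ (hasShape? k d) (OneShort.generate n) (wrapped n))
        (cong (OneShort.coefficient n k d +_) (count-wrapped n k d))))

shift-split : ∀ a b e n k d → shift coefficient a b e n k d ≡
  shift Settled.coefficient a b e n k d
    + (shift OneShort.coefficient a b e n k d + shift OneShort.coefficient a b e n k d)
shift-split a b e n k d with (a ≤ᵇ n) ∧ ((b ≤ᵇ k) ∧ (e ≤ᵇ d))
... | true  = coefficient-split (n ∸ a) (k ∸ b) (d ∸ e)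
... | false = refl

base-numer : ∀ m k d → m ≢ 1 →
  count k d (baseSettled (suc m)) + (count k d (baseOneShort (suc m)) + count k d (baseOneShort (suc m)))
  ≡ numer (suc m) k d
base-numer 0                         k                   d             _   = refl
base-numer 1                         k                   d             m≢1 = ⊥-elim (m≢1 refl)
base-numer 2                         k                   d             _   = refl
base-numer 3                         0                   d             _   = refl
base-numer 3                         1                   0             _   = refl
base-numer 3                         1                   1             _   = refl
base-numer 3                         1                   (suc (suc d)) _   = refl
base-numer 3                         2                   0             _   = refl
base-numer 3                         2                   (suc d)       _   = refl
base-numer 3                         (suc (suc (suc k))) d             _   = refl
base-numer (suc (suc (suc (suc m)))) k                   d             _   = refl

open +-*-Solver

rearrange : ∀ bL bD l₁ l₂ l₃ l₄ l₅ d₁ d₂ d₃ d₄ d₅ →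
  let L = l₁ + (l₂ + (l₃ + (l₄ + (l₅ + 0))))
      D = d₁ + (d₂ + (d₃ + (d₄ + (d₅ + 0))))
  in (bL + L) + ((bD + D) + (bD + D)) ≡
     (bL + (bD + bD)) + (l₁ + (d₁ + d₁)) + (l₂ + (d₂ + d₂)) + (l₃ + (d₃ + d₃)) + (l₄ + (d₄ + d₄)) + (l₅ + (d₅ + d₅))
rearrange = solve 12 (λ bL bD l₁ l₂ l₃ l₄ l₅ d₁ d₂ d₃ d₄ d₅ →
  let L = l₁ :+ (l₂ :+ (l₃ :+ (l₄ :+ (l₅ :+ con 0))))
      D = d₁ :+ (d₂ :+ (d₃ :+ (d₄ :+ (d₅ :+ con 0))))
  in (bL :+ L) :+ ((bD :+ D) :+ (bD :+ D)) :=
     (bL :+ (bD :+ bD)) :+ (l₁ :+ (d₁ :+ d₁)) :+ (l₂ :+ (d₂ :+ d₂)) :+ (l₃ :+ (d₃ :+ d₃)) :+ (l₄ :+ (d₄ :+ d₄))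
       :+ (l₅ :+ (d₅ :+ d₅))) refl

coefficient-recurrence : ∀ m k d → m ≢ 1 → coefficient (suc m) k d ≡
  numer (suc m) k d + shift coefficient 1 0 0 (suc m) k d + shift coefficient 2 0 1 (suc m) k d
    + shift coefficient 3 1 0 (suc m) k d + shift coefficient 5 1 1 (suc m) k d + shift coefficient 5 2 0 (suc m) k d
coefficient-recurrence m k d m≢1 =
  trans (coefficient-split (suc m) k d)
  (trans (cong₂ _+_ (Settled.coefficient-suc m k d m≢1)
                    (cong₂ _+_ (OneShort.coefficient-suc m k d m≢1) (OneShort.coefficient-suc m k d m≢1)))
  (trans (rearrange (count k d (baseSettled (suc m))) (count k d (baseOneShort (suc m)))
                    (ℓ 1 0 0) (ℓ 2 0 1) (ℓ 3 1 0) (ℓ 5 1 1) (ℓ 5 2 0) (o 1 0 0) (o 2 0 1) (o 3 1 0) (o 5 1 1) (o 5 2 0))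
  (cong₂ _+_ (cong₂ _+_ (cong₂ _+_ (cong₂ _+_ (cong₂ _+_ (base-numer m k d m≢1)
    (merge 1 0 0)) (merge 2 0 1)) (merge 3 1 0)) (merge 5 1 1)) (merge 5 2 0))))
  where
  ℓ o : ℕ → ℕ → ℕ → ℕ
  ℓ a b e = shift Settled.coefficient a b e (suc m) k d
  o a b e = shift OneShort.coefficient a b e (suc m) k d
  merge : ∀ a b e → ℓ a b e + (o a b e + o a b e) ≡ shift coefficient a b e (suc m) k d
  merge a b e = sym (shift-split a b e (suc m) k d)

-- Lengths 0 and 2 are checked by evaluation: the recurrence needs a predecessor, and at
-- length 2 the widening step has no source.
coefficient-satisfiesGF : SatisfiesGF coefficient
coefficient-satisfiesGF 0 0       0       = refl
coefficient-satisfiesGF 0 0       (suc d) = refl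
coefficient-satisfiesGF 0 (suc k) d       = refl
coefficient-satisfiesGF 2 0             0             = refl
coefficient-satisfiesGF 2 0             1             = refl
coefficient-satisfiesGF 2 0             (suc (suc d)) = refl
coefficient-satisfiesGF 2 1             0             = refl
coefficient-satisfiesGF 2 1             1             = refl
coefficient-satisfiesGF 2 1             (suc (suc d)) = refl
coefficient-satisfiesGF 2 (suc (suc k)) 0             = refl
coefficient-satisfiesGF 2 (suc (suc k)) 1             = refl
coefficient-satisfiesGF 2 (suc (suc k)) (suc (suc d)) = refl
coefficient-satisfiesGF 1                   k d = coefficient-recurrence 0 k d (λ ())
coefficient-satisfiesGF (suc (suc (suc m))) k d = coefficient-recurrence (suc (suc m)) k d (λ ())

-- Induced subcubes of the hypercube

flip : ∀ {n} → Vec Bool n → Fin n → Vec Bool n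
flip v j = updateAt v j not

hamming-self : ∀ {n} (u : Vec Bool n) → hamming u u ≡ 0
hamming-self []          = refl
hamming-self (true ∷ u)  = hamming-self u
hamming-self (false ∷ u) = hamming-self u

hamming≡0 : ∀ {n} {u w : Vec Bool n} → hamming u w ≡ 0 → u ≡ w
hamming≡0 {u = []}         {[]}         _ = refl
hamming≡0 {u = true ∷ u}  {true ∷ w}  h = cong (true ∷_) (hamming≡0 h)
hamming≡0 {u = false ∷ u} {false ∷ w} h = cong (false ∷_) (hamming≡0 h)

adj⇒flip : ∀ {n} {u w : Vec Bool n} → Adj u w → ∃ λ j → w ≡ flip u j
adj⇒flip {u = []}         {[]}         ()
adj⇒flip {u = true ∷ u}  {true ∷ w}  h = let j , e = adj⇒flip h in suc j , cong (true ∷_) e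
adj⇒flip {u = false ∷ u} {false ∷ w} h = let j , e = adj⇒flip h in suc j , cong (false ∷_) e
adj⇒flip {u = true ∷ u}  {false ∷ w} h = zero , cong (false ∷_) (sym (hamming≡0 (suc-injective h)))
adj⇒flip {u = false ∷ u} {true ∷ w}  h = zero , cong (true ∷_) (sym (hamming≡0 (suc-injective h)))

flip-adj : ∀ {n} (u : Vec Bool n) j → Adj u (flip u j)
flip-adj (true ∷ u)  zero    = cong suc (hamming-self u)
flip-adj (false ∷ u) zero    = cong suc (hamming-self u)
flip-adj (true ∷ u)  (suc j) = flip-adj u j
flip-adj (false ∷ u) (suc j) = flip-adj u j

flip-involutive : ∀ {n} (v : Vec Bool n) j → flip (flip v j) j ≡ v
flip-involutive (b ∷ v) zero    = cong (_∷ v) (not-involutive b)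
flip-involutive (b ∷ v) (suc j) = cong (b ∷_) (flip-involutive v j)

-- Writing v + a for flip v a: in a 4-cycle v, v + a, v + a + l = v + j + e, v + j of Q_n
-- the opposite edges l and j flip the same coordinate.
flip-square : ∀ {n} (v : Vec Bool n) a e j l → flip (flip v a) l ≡ flip (flip v j) e →
  flip (flip v a) l ≢ v → flip v a ≢ flip v j → l ≡ j
flip-square v a e j l eq l≢back a≢j with l ≟ᶠ a | l ≟ᶠ j | e ≟ᶠ l
... | yes refl | _       | _        = ⊥-elim (l≢back (flip-involutive v l))
... | no _     | yes l≡j | _        = l≡j
... | no _     | no _    | yes refl = ⊥-elim (a≢j (trans (sym (flip-involutive (flip v a) e))
                                                  (trans (cong (λ w → flip w e) eq) (flip-involutive (flip v j) e))))
... | no l≢a   | no l≢j  | no e≢l   =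
  ⊥-elim (not-¬ refl (sym (trans (sym at-l-left) (trans (cong (λ w → lookup w l) eq) at-l-right))))
  where
  at-l-left : lookup (flip (flip v a) l) l ≡ not (lookup v l)
  at-l-left = trans (lookup∘updateAt l (flip v a)) (cong not (lookup∘updateAt′ l a l≢a v))
  at-l-right : lookup (flip (flip v j) e) l ≡ lookup v l
  at-l-right = trans (lookup∘updateAt′ l e (λ l≡e → e≢l (sym l≡e)) (flip v j)) (lookup∘updateAt′ l j l≢j v)

flip-induction : ∀ {k} (P : Vec Bool k → Set) → P (Vec.replicate k false) →
  (∀ u j → P u → P (flip u j)) → ∀ u → P u
flip-induction P p₀ closed []          = p₀
flip-induction P p₀ closed (false ∷ u) = flip-induction (P ∘ (false ∷_)) p₀ (λ w j → closed (false ∷ w) (suc j)) u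
flip-induction P p₀ closed (true ∷ u)  =
  closed (false ∷ u) zero (flip-induction (P ∘ (false ∷_)) p₀ (λ w j → closed (false ∷ w) (suc j)) u)

MatchesV : ∀ {n} → Vec Trit n → Vec Bool n → Set
MatchesV q v = Matches (toList q) (toList v)

matchesV-≔X : ∀ {n} (q : Vec Trit n) j {v} → MatchesV q v → MatchesV (q [ j ]≔ X) v
matchesV-≔X (c ∷ q) zero    {b ∷ v} (a ∷ m) = X-any ∷ m
matchesV-≔X (c ∷ q) (suc j) {b ∷ v} (a ∷ m) = a ∷ matchesV-≔X q j m

matchesV-≔X-flip : ∀ {n} (q : Vec Trit n) j {v} → MatchesV q v → MatchesV (q [ j ]≔ X) (flip v j)
matchesV-≔X-flip (c ∷ q) zero    {b ∷ v} (a ∷ m) = X-any ∷ m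
matchesV-≔X-flip (c ∷ q) (suc j) {b ∷ v} (a ∷ m) = a ∷ matchesV-≔X-flip q j m

matchesV-≔X⁻ : ∀ {n} (q : Vec Trit n) j {v} → MatchesV (q [ j ]≔ X) v → MatchesV q v ⊎ MatchesV q (flip v j)
matchesV-≔X⁻ (O ∷ q) zero {false ∷ v} (_ ∷ m) = inj₁ (O-false ∷ m)
matchesV-≔X⁻ (O ∷ q) zero {true ∷ v}  (_ ∷ m) = inj₂ (O-false ∷ m)
matchesV-≔X⁻ (I ∷ q) zero {true ∷ v}  (_ ∷ m) = inj₁ (I-true ∷ m)
matchesV-≔X⁻ (I ∷ q) zero {false ∷ v} (_ ∷ m) = inj₂ (I-true ∷ m)
matchesV-≔X⁻ (X ∷ q) zero {b ∷ v}     (_ ∷ m) = inj₁ (X-any ∷ m)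
matchesV-≔X⁻ (c ∷ q) (suc j) {b ∷ v} (a ∷ m) with matchesV-≔X⁻ q j m
... | inj₁ m′ = inj₁ (a ∷ m′)
... | inj₂ m′ = inj₂ (a ∷ m′)

matchesV-flip : ∀ {n} (q : Vec Trit n) j {v} → lookup q j ≡ X → MatchesV q v → MatchesV q (flip v j)
matchesV-flip (X ∷ q) zero    {b ∷ v} refl (X-any ∷ m) = X-any ∷ m
matchesV-flip (c ∷ q) (suc j) {b ∷ v} eq   (a ∷ m)     = a ∷ matchesV-flip q j eq m

dim-≔X : ∀ {n} (q : Vec Trit n) j → lookup q j ≢ X → dim (toList (q [ j ]≔ X)) ≡ suc (dim (toList q))
dim-≔X (O ∷ q) zero    _   = refl
dim-≔X (I ∷ q) zero    _   = refl
dim-≔X (X ∷ q) zero    ≢X  = ⊥-elim (≢X refl)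
dim-≔X (O ∷ q) (suc j) ≢X = dim-≔X q j ≢X
dim-≔X (I ∷ q) (suc j) ≢X = dim-≔X q j ≢X
dim-≔X (X ∷ q) (suc j) ≢X = cong suc (dim-≔X q j ≢X)

point : ∀ {n} → Vec Bool n → Vec Trit n
point []          = []
point (true ∷ v)  = I ∷ point v
point (false ∷ v) = O ∷ point v

point-matches : ∀ {n} (v : Vec Bool n) → MatchesV (point v) v
point-matches []          = []
point-matches (true ∷ v)  = I-true ∷ point-matches v
point-matches (false ∷ v) = O-false ∷ point-matches v

point-matches⁻ : ∀ {n} (v : Vec Bool n) {w} → MatchesV (point v) w → w ≡ v
point-matches⁻ []          {[]}    []            = refl
point-matches⁻ (true ∷ v)  {_ ∷ w} (I-true ∷ m)  = cong (true ∷_) (point-matches⁻ v m)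
point-matches⁻ (false ∷ v) {_ ∷ w} (O-false ∷ m) = cong (false ∷_) (point-matches⁻ v m)

dim-point : ∀ {n} (v : Vec Bool n) → dim (toList (point v)) ≡ 0
dim-point []          = refl
dim-point (true ∷ v)  = dim-point v
dim-point (false ∷ v) = dim-point v

CutOut : ∀ {k n} → (Vec Bool k → Vec Bool n) → Vec Trit n → Set
CutOut f q = (∀ u → MatchesV q (f u)) × (∀ {v} → MatchesV q v → ∃ λ u → f u ≡ v)

-- flip-square passes the coordinate flipped by one rung f (0 ∷ u) — f (1 ∷ u) on to the
-- rungs at the neighbours of u.
rungs-parallel : ∀ {k n} (f : Vec Bool (suc k) → Vec Bool n) → (∀ {u w} → f u ≡ f w → u ≡ w) →
  (∀ {u w} → Adj u w → Adj (f u) (f w)) → ∃ λ j → ∀ u → f (true ∷ u) ≡ flip (f (false ∷ u)) j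
rungs-parallel {k} {n} f injective adjacent = j , flip-induction _ (proj₂ (rung zeros)) parallel
  where
  rung : ∀ u → ∃ λ l → f (true ∷ u) ≡ flip (f (false ∷ u)) l
  rung u = adj⇒flip (adjacent {false ∷ u} {true ∷ u} (cong suc (hamming-self u)))
  zeros : Vec Bool k
  zeros = Vec.replicate k false
  j : Fin n
  j = proj₁ (rung zeros)
  halves-disjoint : ∀ u w → f (true ∷ u) ≢ f (false ∷ w)
  halves-disjoint u w eq with () ← injective eq
  parallel : ∀ u i → f (true ∷ u) ≡ flip (f (false ∷ u)) j → f (true ∷ flip u i) ≡ flip (f (false ∷ flip u i)) j
  parallel u i rung-u
    with a , lower ← adj⇒flip (adjacent {false ∷ u} {false ∷ flip u i} (flip-adj u i))
       | e , upper ← adj⇒flip (adjacent {true ∷ u} {true ∷ flip u i} (flip-adj u i))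
       | l , rung-w ← rung (flip u i) =
    subst (λ l → f (true ∷ flip u i) ≡ flip (f (false ∷ flip u i)) l)
      (flip-square (f (false ∷ u)) a e j l
        (trans (cong (λ x → flip x l) (sym lower)) (trans (sym rung-w) (trans upper (cong (λ x → flip x e) rung-u))))
        (λ eq → halves-disjoint (flip u i) u (trans rung-w (trans (cong (λ x → flip x l) lower) eq)))
        (λ eq → halves-disjoint u (flip u i) (sym (trans lower (trans eq (sym rung-u))))))
      rung-w

-- Induction on k: the pattern of the lower half f (0 ∷ _), with X at the coordinate
-- flipped by all rungs, cuts out the whole image.
subcube-pattern : ∀ k {n} (f : Vec Bool k → Vec Bool n) → (∀ {u w} → f u ≡ f w → u ≡ w) →
  (∀ {u w} → Adj u w → Adj (f u) (f w)) → ∃ λ q → dim (toList q) ≡ k × CutOut f q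
subcube-pattern zero f _ _ = point (f []) , dim-point (f []) , (λ { [] → point-matches (f []) }) ,
                             λ m → [] , sym (point-matches⁻ (f []) m)
subcube-pattern (suc k) {n} f injective adjacent
  with q₀ , dim₀ , covers₀ , onto₀ ← subcube-pattern k (f ∘ (false ∷_)) (cong Vec.tail ∘ injective) adjacent
     | j , rungs ← rungs-parallel f injective adjacent =
  q₀ [ j ]≔ X , trans (dim-≔X q₀ j not-X) (cong suc dim₀) , covers , onto
  where
  not-X : lookup q₀ j ≢ X
  not-X eq with u , lower ← onto₀ (matchesV-flip q₀ j eq (covers₀ (Vec.replicate k false)))
    with () ← injective (trans (rungs (Vec.replicate k false)) (sym lower))
  covers : ∀ u → MatchesV (q₀ [ j ]≔ X) (f u)
  covers (false ∷ u) = matchesV-≔X q₀ j (covers₀ u)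
  covers (true ∷ u)  = subst (MatchesV (q₀ [ j ]≔ X)) (sym (rungs u)) (matchesV-≔X-flip q₀ j (covers₀ u))
  onto : ∀ {v} → MatchesV (q₀ [ j ]≔ X) v → ∃ λ u → f u ≡ v
  onto {v} m with matchesV-≔X⁻ q₀ j m
  ... | inj₁ m₀ = let u , eq = onto₀ m₀ in false ∷ u , eq
  ... | inj₂ m₁ = let u , eq = onto₀ m₁ in
                  true ∷ u , trans (rungs u) (trans (cong (λ x → flip x j) eq) (flip-involutive v j))

fill : ∀ {n} (q : Vec Trit n) → Vec Bool (dim (toList q)) → Vec Bool n
fill []      []      = []
fill (O ∷ q) u       = false ∷ fill q u
fill (I ∷ q) u       = true ∷ fill q u
fill (X ∷ q) (b ∷ u) = b ∷ fill q u

extract : ∀ {n} (q : Vec Trit n) → Vec Bool n → Vec Bool (dim (toList q))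
extract []      []      = []
extract (O ∷ q) (_ ∷ v) = extract q v
extract (I ∷ q) (_ ∷ v) = extract q v
extract (X ∷ q) (b ∷ v) = b ∷ extract q v

fill-matches : ∀ {n} (q : Vec Trit n) u → MatchesV q (fill q u)
fill-matches []      []      = []
fill-matches (O ∷ q) u       = O-false ∷ fill-matches q u
fill-matches (I ∷ q) u       = I-true ∷ fill-matches q u
fill-matches (X ∷ q) (b ∷ u) = X-any ∷ fill-matches q u

fill-extract : ∀ {n} (q : Vec Trit n) {v} → MatchesV q v → fill q (extract q v) ≡ v
fill-extract []      {[]}    []            = refl
fill-extract (O ∷ q) {_ ∷ v} (O-false ∷ m) = cong (false ∷_) (fill-extract q m)
fill-extract (I ∷ q) {_ ∷ v} (I-true ∷ m)  = cong (true ∷_) (fill-extract q m)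
fill-extract (X ∷ q) {b ∷ v} (X-any ∷ m)   = cong (b ∷_) (fill-extract q m)

extract-fill : ∀ {n} (q : Vec Trit n) u → extract q (fill q u) ≡ u
extract-fill []      []      = refl
extract-fill (O ∷ q) u       = extract-fill q u
extract-fill (I ∷ q) u       = extract-fill q u
extract-fill (X ∷ q) (b ∷ u) = cong (b ∷_) (extract-fill q u)

hamming-fill : ∀ {n} (q : Vec Trit n) u w → hamming (fill q u) (fill q w) ≡ hamming u w
hamming-fill []      []          []          = refl
hamming-fill (O ∷ q) u           w           = hamming-fill q u w
hamming-fill (I ∷ q) u           w           = hamming-fill q u w
hamming-fill (X ∷ q) (true ∷ u)  (true ∷ w)  = hamming-fill q u w
hamming-fill (X ∷ q) (false ∷ u) (false ∷ w) = hamming-fill q u w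
hamming-fill (X ∷ q) (true ∷ u)  (false ∷ w) = cong suc (hamming-fill q u w)
hamming-fill (X ∷ q) (false ∷ u) (true ∷ w)  = cong suc (hamming-fill q u w)

weight-fill : ∀ {n} (q : Vec Trit n) u → weight (fill q u) ≡ bottom (toList q) + weight u
weight-fill []      []          = refl
weight-fill (O ∷ q) u           = weight-fill q u
weight-fill (I ∷ q) u           = cong suc (weight-fill q u)
weight-fill (X ∷ q) (true ∷ u)  = trans (cong suc (weight-fill q u)) (sym (+-suc (bottom (toList q)) (weight u)))
weight-fill (X ∷ q) (false ∷ u) = weight-fill q u

weight-zeros : ∀ k → weight (Vec.replicate k false) ≡ 0
weight-zeros zero    = refl
weight-zeros (suc k) = weight-zeros k

bottomVertex : ∀ {n} (q : Vec Trit n) → Vec Bool n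
bottomVertex q = fill q (Vec.replicate (dim (toList q)) false)

weight-bottomVertex : ∀ {n} (q : Vec Trit n) → weight (bottomVertex q) ≡ bottom (toList q)
weight-bottomVertex q =
  trans (weight-fill q _) (trans (cong (bottom (toList q) +_) (weight-zeros (dim (toList q)))) (+-identityʳ _))

bottom≤weight : ∀ {n} (q : Vec Trit n) {v} → MatchesV q v → bottom (toList q) ≤ weight v
bottom≤weight q {v} m =
  subst (bottom (toList q) ≤_) (trans (sym (weight-fill q (extract q v))) (cong weight (fill-extract q m))) (m≤m+n _ _)

allV-complete : ∀ n (v : Vec Bool n) → v ∈ allV n
allV-complete zero    []          = here refl
allV-complete (suc n) (false ∷ v) = ∈-++⁺ˡ (∈-map⁺ (false ∷_) (allV-complete n v))
allV-complete (suc n) (true ∷ v)  = ∈-++⁺ʳ (map (false ∷_) (allV n)) (∈-map⁺ (true ∷_) (allV-complete n v))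

allV-unique : ∀ n → Unique (allV n)
allV-unique zero    = [] ∷ []
allV-unique (suc n) = Unique.++⁺ (Unique.map⁺ (cong Vec.tail) (allV-unique n))
                                 (Unique.map⁺ (cong Vec.tail) (allV-unique n)) disjoint
  where
  disjoint : ∀ {v} → v ∈ map (false ∷_) (allV n) × v ∈ map (true ∷_) (allV n) → ⊥
  disjoint (m₁ , m₂) with _ , _ , refl ← ∈-map⁻ (false ∷_) m₁ | _ , _ , () ← ∈-map⁻ (true ∷_) m₂

mask : ℕ → List Trit → List Bool
mask n p = map (λ v → does (matches? p (toList v))) (allV n)

∈-select-mask : ∀ n p {v} → v ∈ select (mask n p) (allV n) ⇔ Matches p (toList v)
∈-select-mask n p {v} = let does⇔ = does≡true⇔ (matches? p (toList v)) in mk⇔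
  (λ s → Equivalence.to does⇔ (∈-select-map⁻ _ (allV n) s))
  (λ m → ∈-select-map⁺ _ (allV n) (allV-complete n v) (Equivalence.from does⇔ m))

mask-injective : ∀ n {p p′} → length p ≡ n → length p′ ≡ n → mask n p ≡ mask n p′ → p ≡ p′
mask-injective n {p} {p′} lp lp′ eq = matches-injective (transfer lp eq) (transfer lp′ (sym eq))
  where
  transfer : ∀ {p p′} → length p ≡ n → mask n p ≡ mask n p′ → ∀ {s} → Matches p s → Matches p′ s
  transfer {p} {p′} lp eq {s} m with v , refl ← toList-onto s (trans (sym (Pointwise-length m)) lp) =
    Equivalence.to (∈-select-mask n p′)
      (subst (λ m′ → v ∈ select m′ (allV n)) eq (Equivalence.from (∈-select-mask n p) m))

subcube-LRCube : ∀ {n} (q : Vec Trit n) → Valid (toList q) →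
  LRCube n (dim (toList q)) (bottom (toList q)) (mask n (toList q))
subcube-LRCube {n} q valid =
  length-map _ (allV n) ,
  All.tabulate (λ s → valid (Equivalence.to S⇔ s)) ,
  (fill q , (λ u → Equivalence.from S⇔ (fill-matches q u)) ,
    (λ v s → extract q v , fill-extract q (Equivalence.to S⇔ s)) ,
    (λ u w eq → trans (sym (extract-fill q u)) (trans (cong (extract q) eq) (extract-fill q w))) ,
    (λ u w → mk⇔ (trans (hamming-fill q u w)) (trans (sym (hamming-fill q u w))))) ,
  (bottomVertex q , Equivalence.from S⇔ (fill-matches q _) , weight-bottomVertex q) ,
  (λ v s → bottom≤weight q (Equivalence.to S⇔ s))
  where
  S⇔ : ∀ {v} → v ∈ select (mask n (toList q)) (allV n) ⇔ MatchesV q v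
  S⇔ = ∈-select-mask n (toList q)

LRCube-subcube : ∀ {n k d m} → LRCube n k d m →
  Σ (Vec Trit n) λ q → Valid (toList q) × dim (toList q) ≡ k × bottom (toList q) ≡ d × m ≡ mask n (toList q)
LRCube-subcube {n} {k} {d} {m} (len , lucas , (f , f∈ , onto , injective , adjacent) , (v₀ , v₀∈ , wv₀) , lower-bound)
  with q , dimq , covers , ontoq ← subcube-pattern k f (injective _ _) (λ {u} {w} → Equivalence.to (adjacent u w)) =
  q , valid , dimq , bottom≡ , mask≡
  where
  S⇔ : ∀ {v} → v ∈ select m (allV n) ⇔ MatchesV q v
  S⇔ {v} = mk⇔ (λ s → let u , fu≡v = onto v s in subst (MatchesV q) fu≡v (covers u))
                (λ mv → let u , fu≡v = ontoq mv in subst (_∈ select m (allV n)) fu≡v (f∈ u))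
  mask≡ : m ≡ mask n (toList q)
  mask≡ = select-determines-mask _ (allV n) m (allV-unique n) len
    (λ {v} _ → ⇔-trans S⇔ (⇔-sym (does≡true⇔ (matches? (toList q) (toList v)))))
  valid : Valid (toList q)
  valid {s} ms with v , refl ← toList-onto s (trans (sym (Pointwise-length ms)) (length-toList q)) =
    All.lookup lucas (Equivalence.from S⇔ ms)
  bottom≡ : bottom (toList q) ≡ d
  bottom≡ = ≤-antisym
    (subst (bottom (toList q) ≤_) wv₀ (bottom≤weight q (Equivalence.to S⇔ v₀∈)))
    (subst (d ≤_) (weight-bottomVertex q) (lower-bound (bottomVertex q) (Equivalence.from S⇔ (fill-matches q _))))

cubeMasks : ℕ → ℕ → ℕ → List (List Bool)
cubeMasks n k d = map (mask n) (filter (hasShape? k d) (lucasPatterns n))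

cubeMasks-sound : ∀ n k d {m} → m ∈ cubeMasks n k d → LRCube n k d m
cubeMasks-sound n k d mm
  with p , p∈ , refl ← ∈-map⁻ (mask n) mm
  with p∈′ , refl , refl ← ∈-filter⁻ (hasShape? k d) {xs = lucasPatterns n} p∈
  with lp , lucas ← lucasPatterns-sound n p∈′
  with q , refl ← toList-onto p lp =
  subcube-LRCube q (Equivalence.from (valid⇔lucasPattern (toList q)) lucas)

cubeMasks-complete : ∀ n k d {m} → LRCube n k d m → m ∈ cubeMasks n k d
cubeMasks-complete n k d {m} cube with q , valid , refl , refl , refl ← LRCube-subcube {m = m} cube =
  ∈-map⁺ (mask n) (∈-filter⁺ (hasShape? k d) (subst (λ l → toList q ∈ lucasPatterns l) (length-toList q)
    (lucasPatterns-complete (Equivalence.to (valid⇔lucasPattern (toList q)) valid))) (refl , refl))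

cubeMasks-unique : ∀ n k d → Unique (cubeMasks n k d)
cubeMasks-unique n k d =
  Unique-map⁺-local (mask n) (Unique.filter⁺ (hasShape? k d) (lucasPatterns-unique n))
    (λ mp mp′ → mask-injective n (length-of mp) (length-of mp′))
  where
  length-of : ∀ {p} → p ∈ filter (hasShape? k d) (lucasPatterns n) → length p ≡ n
  length-of m = proj₁ (lucasPatterns-sound n (proj₁ (∈-filter⁻ (hasShape? k d) m)))

mainTheorem6 : Σ (ℕ → ℕ → ℕ → ℕ) λ c →
    (∀ n k d → HasCount (LRCube n k d) (c n k d)) × SatisfiesGF c
mainTheorem6 =
  coefficient ,
  (λ n k d → cubeMasks n k d , cubeMasks-unique n k d ,
             (λ m → mk⇔ (cubeMasks-sound n k d) (cubeMasks-complete n k d)) ,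
             length-map (mask n) (filter (hasShape? k d) (lucasPatterns n))) ,
  coefficient-satisfiesGF
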